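{- Let $\Gamma$ be a finite connected graph that is locally $n\times n$ grid, and assume all $\mu$-graphs of $\Gamma$ have order at least $2(n-1)$. Then $\operatorname{diam}(\Gamma)\leq 3$, and $d_\Gamma(x,C)\in\{1,2\}$ for every vertex $x$ and every maximal clique $C$ not containing $x$. Furthermore: (1) If $d_\Gamma(x,C)=1$, then the number of vertices $y\in C\cap\Gamma_2(x)$ with $c_2(x,y)=2(n-1)$ is even; moreover, if $n$ is even then $c_2(x,z)=2n$ for some $z\in C\cap\Gamma_2(x)$. (2) If $d_\Gamma(x,C)=2$, then every $y\in C\cap\Gamma_2(x)$ satisfies $c_2(x,y)=2(n-1)$; moreover, if $n$ is even then $C\not\subseteq\Gamma_2(x)$.
   Context: A graph is locally $n\times n$ grid if the induced subgraph on every vertex neighbourhood is isomorphic to $K_n\square K_n$ (vertices $(i,j)$, $1\le i,j\le n$, adjacent iff they agree in exactly one coordinate). For $x,y$ at distance $2$ the $\mu$-graph is the induced subgraph on their common neighbours, of order $c_2(x,y)=|\Gamma(x)\cap\Gamma(y)|$. $\Gamma_2(x)$ is the set of vertices at distance $2$ from $x$; $d_\Gamma(x,C)=\min_{z\in C}d_\Gamma(x,z)$. -}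

module Defs where

open import Data.Nat using (ℕ; zero; suc; _≤_; _<_; _*_; _∸_)
open import Data.Bool using (Bool; true; false; T; _∧_)
open import Data.Fin using (Fin)
open import Data.Fin.Subset using (Subset; _∈_; _⊆_; ∣_∣)
open import Data.Vec using (tabulate)
open import Data.Product using (Σ; ∃; _×_; _,_; proj₁)
open import Data.Sum using (_⊎_)
open import Relation.Nullary using (¬_)
open import Relation.Binary.PropositionalEquality using (_≡_; _≢_)
open import Function.Bundles using (_↔_; Inverse; _⇔_)

record Graph : Set where
  field
    N      : ℕ
    adj    : Fin N → Fin N → Bool
    sym    : ∀ x y → adj x y ≡ adj y x
    irrefl : ∀ x → adj x x ≡ false

module _ (G : Graph) where
  open Graph G

  V : Set
  V = Fin N

  Adj : V → V → Set
  Adj x y = T (adj x y)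

  data Walk : V → V → ℕ → Set where
    nil  : ∀ {x} → Walk x x 0
    cons : ∀ {x y z k} → Adj x y → Walk y z k → Walk x z (suc k)

  Connected : Set
  Connected = ∀ x y → ∃ λ k → Walk x y k

  DistLe : V → V → ℕ → Set
  DistLe x y k = ∃ λ m → m ≤ k × Walk x y m

  Dist : V → V → ℕ → Set
  Dist x y d = DistLe x y d × (∀ m → m < d → ¬ DistLe x y m)

  DiamLe : ℕ → Set
  DiamLe k = ∀ x y → DistLe x y k

  SetDistLe : V → Subset N → ℕ → Set
  SetDistLe x C k = ∃ λ z → z ∈ C × DistLe x z k

  SetDist : V → Subset N → ℕ → Set
  SetDist x C d = SetDistLe x C d × (∀ m → m < d → ¬ SetDistLe x C m)

  common : V → V → Subset N
  common x y = tabulate (λ z → adj x z ∧ adj y z)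

  c₂ : V → V → ℕ
  c₂ x y = ∣ common x y ∣

  MuGraphsAtLeast : ℕ → Set
  MuGraphsAtLeast m = ∀ x y → Dist x y 2 → m ≤ c₂ x y

  IsClique : Subset N → Set
  IsClique C = ∀ y z → y ∈ C → z ∈ C → y ≢ z → Adj y z

  IsMaximalClique : Subset N → Set
  IsMaximalClique C = IsClique C × (∀ D → IsClique D → C ⊆ D → D ⊆ C)

  Nbhd : V → Set
  Nbhd x = Σ V (λ v → Adj x v)

  LocallyGrid : ℕ → Set
  LocallyGrid n = ∀ x → Σ ((Fin n × Fin n) ↔ Nbhd x) λ f →
    ∀ p q → Adj (proj₁ (Inverse.to f p)) (proj₁ (Inverse.to f q)) ⇔ RookAdj p q
    where
    -- adjacency in K_n □ K_n
    RookAdj : Fin n × Fin n → Fin n × Fin n → Set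
    RookAdj (i , j) (k , l) = (i ≡ k × j ≢ l) ⊎ (i ≢ k × j ≡ l)

-- Each neighbourhood Γ(x) is identified with the rook's graph K_n □ K_n on the cells
-- of an n × n grid (LocalGrid). Inside such a grid:
--   * the μ-graph of x and y is "μ-shaped" and meets every row in 0 or 2 cells, so c₂(x,y) is
--     even and at most 2n, at most 2(n-1) if it misses a line, and at most 2(n-2) if it misses
--     the crosses of two cells (CellCount, MuGraphs);
--   * a maximal clique C through c is c together with a line of c's grid, so |C| = n + 1 and a
--     vertex outside C adjacent to C has exactly two neighbours in C (MaximalCliques).
-- By the 2(n-2) bound a vertex at distance 2 from x has at most one neighbour farther away,
-- which gives diam Γ ≤ 3 and d(x,C) ≤ 2 (Diameter, OutsideVertex). The parity statements come
-- from double counting paths x ~ u ~ z with z ∈ C (CommonNeighbours): the neighbours of x that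
-- see C only through non-neighbours of x pair up, so they are evenly many, and comparing the
-- two counts (FarFromClique, NearClique, Arithmetic) gives (1) and (2).
module Submission where

open import Defs
open import Data.Nat using (ℕ; zero; suc; _+_; _*_; _∸_; _≤_; _<_; z≤n; s≤s; s≤s⁻¹; _≡ᵇ_)
open import Data.Nat.Properties hiding (_≟_; suc-injective)
open import Data.Nat.Divisibility using (_∣_; divides)
open import Data.Bool using (Bool; true; false; T; _∧_; _∨_; not; _xor_)
open import Data.Bool.Properties using (T-irrelevant; ∧-comm; T-≡; T-not-≡; T-∧; T-∨; T?)
open import Data.Fin using (Fin; zero; suc)
open import Data.Fin.Properties using (_≟_; suc-injective)
open import Data.Fin.Subset using (Subset; _∈_; _∉_; ∣_∣)
open import Data.Vec using ([]; _∷_; lookup; tabulate)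
open import Data.Vec.Properties using (lookup∘tabulate; []=↔lookup)
open import Data.Empty using (⊥; ⊥-elim)
open import Data.Unit using (tt)
open import Data.Product using (Σ; ∃; _×_; _,_; proj₁; proj₂)
open import Data.Product.Properties using (≡-dec)
open import Data.Sum using (_⊎_; inj₁; inj₂; [_,_]′)
open import Relation.Nullary using (¬_; Dec; yes; no)
open import Relation.Nullary.Decidable using (⌊_⌋; toWitness; fromWitness)
open import Relation.Binary.PropositionalEquality
open import Function.Bundles using (_⇔_; Inverse; Equivalence)
open import Algebra.Properties.Semiring.Sum +-*-semiring
  using (sum; sum-cong-≗; ∑-distrib-+; ∑-comm; *-distribˡ-sum; sum-replicate-zero)

module Booleans where

  T-true : ∀ {b} → T b → b ≡ true
  T-true = Equivalence.to T-≡

  true-T : ∀ {b} → b ≡ true → T b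
  true-T = Equivalence.from T-≡

  ¬T-false : ∀ {b} → ¬ T b → b ≡ false
  ¬T-false {true} h = ⊥-elim (h tt)
  ¬T-false {false} h = refl

  T-ext : ∀ {a b} → (T a → T b) → (T b → T a) → a ≡ b
  T-ext {true} {true} f g = refl
  T-ext {true} {false} f g = ⊥-elim (f tt)
  T-ext {false} {true} f g = ⊥-elim (g tt)
  T-ext {false} {false} f g = refl

  ∧-intro : ∀ {a b} → T a → T b → T (a ∧ b)
  ∧-intro p q = Equivalence.from T-∧ (p , q)

  ∧-elimˡ : ∀ {a b} → T (a ∧ b) → T a
  ∧-elimˡ {a} {b} t = proj₁ (Equivalence.to (T-∧ {a} {b}) t)

  ∧-elimʳ : ∀ {a b} → T (a ∧ b) → T b
  ∧-elimʳ {a} {b} t = proj₂ (Equivalence.to (T-∧ {a} {b}) t)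

  not-intro : ∀ {a} → ¬ T a → T (not a)
  not-intro h = Equivalence.from T-not-≡ (¬T-false h)

  not-elim : ∀ {a} → T (not a) → ¬ T a
  not-elim t ta = subst T (Equivalence.to T-not-≡ t) ta

  not-not : ∀ {a} → ¬ T (not a) → T a
  not-not {true} _ = tt
  not-not {false} h = ⊥-elim (h tt)

  ¬∧ : ∀ {a b} → ¬ T (a ∧ b) → ¬ T a ⊎ ¬ T b
  ¬∧ {true} h = inj₂ h
  ¬∧ {false} h = inj₁ (λ ())

  ∨-introˡ : ∀ {a b} → T a → T (a ∨ b)
  ∨-introˡ t = Equivalence.from T-∨ (inj₁ t)

  ∨-introʳ : ∀ {a b} → T b → T (a ∨ b)
  ∨-introʳ t = Equivalence.from T-∨ (inj₂ t)

  ∨-elim : ∀ {a b} → T (a ∨ b) → T a ⊎ T b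
  ∨-elim {a} {b} = Equivalence.to (T-∨ {a} {b})

  _==_ : ∀ {k} → Fin k → Fin k → Bool
  i == j = ⌊ i ≟ j ⌋

  ==→≡ : ∀ {k} {i j : Fin k} → T (i == j) → i ≡ j
  ==→≡ {i = i} {j} = toWitness {a? = i ≟ j}

  ≡→== : ∀ {k} {i j : Fin k} → i ≡ j → T (i == j)
  ≡→== {i = i} {j} = fromWitness {a? = i ≟ j}

  ==-refl : ∀ {k} (i : Fin k) → T (i == i)
  ==-refl i = ≡→== refl

  ≢→== : ∀ {k} {i j : Fin k} → i ≢ j → (i == j) ≡ false
  ≢→== ne = ¬T-false (λ t → ne (==→≡ t))

  ==-sym : ∀ {k} (i j : Fin k) → (i == j) ≡ (j == i)
  ==-sym i j = T-ext (λ t → ≡→== (sym (==→≡ t))) (λ t → ≡→== (sym (==→≡ t)))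

  any? : ∀ {k} → (Fin k → Bool) → Bool
  any? {zero} f = false
  any? {suc k} f = f zero ∨ any? (λ i → f (suc i))

  any?-intro : ∀ {k} (f : Fin k → Bool) (i : Fin k) → T (f i) → T (any? f)
  any?-intro f zero t = ∨-introˡ t
  any?-intro f (suc i) t = ∨-introʳ {f zero} (any?-intro (λ i → f (suc i)) i t)

  any?-elim : ∀ {k} (f : Fin k → Bool) → T (any? f) → ∃ λ i → T (f i)
  any?-elim {suc k} f t with ∨-elim {f zero} t
  ... | inj₁ t₀ = zero , t₀
  ... | inj₂ t' with any?-elim (λ i → f (suc i)) t'
  ...   | i , tᵢ = suc i , tᵢ

  search : ∀ {k} (f : Fin k → Bool) → (∃ λ i → T (f i)) ⊎ (∀ i → ¬ T (f i))
  search f with any? f in eq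
  ... | true = inj₁ (any?-elim f (true-T eq))
  ... | false = inj₂ (λ i t → subst T eq (any?-intro f i t))

module Membership where
  open Booleans

  ∈→T : ∀ {k} {C : Subset k} {z} → z ∈ C → T (lookup C z)
  ∈→T h = true-T (Inverse.to []=↔lookup h)

  T→∈ : ∀ {k} {C : Subset k} {z} → T (lookup C z) → z ∈ C
  T→∈ t = Inverse.from []=↔lookup (T-true t)

  ∈-tabulate⁻ : ∀ {k} (f : Fin k → Bool) z → z ∈ tabulate f → T (f z)
  ∈-tabulate⁻ f z h = subst T (lookup∘tabulate f z) (∈→T h)

  ∈-tabulate⁺ : ∀ {k} (f : Fin k → Bool) z → T (f z) → z ∈ tabulate f
  ∈-tabulate⁺ f z t = T→∈ (subst T (sym (lookup∘tabulate f z)) t)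

module Counting where
  open Booleans

  𝟙 : Bool → ℕ
  𝟙 true = 1
  𝟙 false = 0

  count : ∀ {k} → (Fin k → Bool) → ℕ
  count f = sum (λ i → 𝟙 (f i))

  count-ext : ∀ {k} {f g : Fin k → Bool} → (∀ i → f i ≡ g i) → count f ≡ count g
  count-ext h = sum-cong-≗ (λ i → cong 𝟙 (h i))

  count-ext⇔ : ∀ {k} {f g : Fin k → Bool} → (∀ i → T (f i) → T (g i)) → (∀ i → T (g i) → T (f i)) →
               count f ≡ count g
  count-ext⇔ h h' = count-ext (λ i → T-ext (h i) (h' i))

  sum-zero : ∀ {k} {f : Fin k → ℕ} → (∀ i → f i ≡ 0) → sum f ≡ 0
  sum-zero {k} h = trans (sum-cong-≗ h) (sum-replicate-zero k)

  sum-single : ∀ {k} (i₀ : Fin k) (f : Fin k → ℕ) → (∀ i → i ≢ i₀ → f i ≡ 0) → sum f ≡ f i₀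
  sum-single {suc k} zero f h = trans (cong (f zero +_) (sum-zero (λ i → h (suc i) (λ ())))) (+-identityʳ _)
  sum-single {suc k} (suc i₀) f h =
    trans (cong (_+ sum (λ i → f (suc i))) (h zero (λ ())))
          (sum-single i₀ (λ i → f (suc i)) (λ i ne → h (suc i) (λ e → ne (suc-injective e))))

  sum-mono : ∀ {k} {f g : Fin k → ℕ} → (∀ i → f i ≤ g i) → sum f ≤ sum g
  sum-mono {zero} h = z≤n
  sum-mono {suc k} h = +-mono-≤ (h zero) (sum-mono (λ i → h (suc i)))

  count-mono : ∀ {k} {f g : Fin k → Bool} → (∀ i → T (f i) → T (g i)) → count f ≤ count g
  count-mono {f = f} {g} h = sum-mono (λ i → 𝟙-mono (f i) (g i) (h i))
    where
    𝟙-mono : ∀ a b → (T a → T b) → 𝟙 a ≤ 𝟙 b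
    𝟙-mono true b t with b | t tt
    ... | true | _ = ≤-refl
    𝟙-mono false b t = z≤n

  count-all : ∀ {k} → count {k} (λ _ → true) ≡ k
  count-all {zero} = refl
  count-all {suc k} = cong suc (count-all {k})

  count-none : ∀ {k} (f : Fin k → Bool) → (∀ i → ¬ T (f i)) → count f ≡ 0
  count-none f h = sum-zero (λ i → cong 𝟙 (¬T-false (h i)))

  count-at : ∀ {k} (f : Fin k → Bool) (i₀ : Fin k) → (∀ i → T (f i) → i ≡ i₀) → count f ≡ 𝟙 (f i₀)
  count-at f i₀ h = sum-single i₀ (λ i → 𝟙 (f i)) (λ i ne → cong 𝟙 (¬T-false (λ t → ne (h i t))))

  count-single : ∀ {k} (f : Fin k → Bool) (i₀ : Fin k) → T (f i₀) → (∀ i → T (f i) → i ≡ i₀) → count f ≡ 1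
  count-single f i₀ t h = trans (count-at f i₀ h) (cong 𝟙 (T-true t))

  count-split : ∀ {k} (g f : Fin k → Bool) → count f ≡ count (λ i → g i ∧ f i) + count (λ i → not (g i) ∧ f i)
  count-split g f = trans (sum-cong-≗ (λ i → split (g i) (f i)))
                          (∑-distrib-+ (λ i → 𝟙 (g i ∧ f i)) (λ i → 𝟙 (not (g i) ∧ f i)))
    where
    split : ∀ a b → 𝟙 b ≡ 𝟙 (a ∧ b) + 𝟙 (not a ∧ b)
    split true b = sym (+-identityʳ _)
    split false b = refl

  𝟙-*-count : ∀ {k} b (f : Fin k → Bool) → 𝟙 b * count f ≡ count (λ i → b ∧ f i)
  𝟙-*-count true f = +-identityʳ _
  𝟙-*-count false f = sym (sum-zero {f = λ i → 𝟙 (false ∧ f i)} (λ i → refl))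

  one-sided : ∀ k p q → T (p ∨ q) → k + (𝟙 p + 𝟙 q) ≡ 2 → k ≡ 𝟙 (p xor q)
  one-sided k true true _ e = +-cancelʳ-≡ 2 k 0 e
  one-sided k true false _ e = +-cancelʳ-≡ 1 k 1 e
  one-sided k false true _ e = +-cancelʳ-≡ 1 k 1 e

  count-others : ∀ {k} (i₀ : Fin k) → count (λ i → not (i == i₀)) ≡ k ∸ 1
  count-others {k} i₀ = begin
      count (λ i → not (i == i₀))
    ≡⟨ sym (m+n∸m≡n 1 _) ⟩
      1 + count (λ i → not (i == i₀)) ∸ 1
    ≡⟨ cong (λ t → t + count (λ i → not (i == i₀)) ∸ 1) (sym one) ⟩
      count (λ i → i == i₀) + count (λ i → not (i == i₀)) ∸ 1
    ≡⟨ cong (_∸ 1) (sym (trans (count-split (_== i₀) (λ _ → true))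
                          (cong₂ _+_ (count-ext (λ i → ∧-true (i == i₀))) (count-ext (λ i → ∧-true (not (i == i₀))))))) ⟩
      count {k} (λ _ → true) ∸ 1
    ≡⟨ cong (_∸ 1) (count-all {k}) ⟩
      k ∸ 1
    ∎
    where
    open ≡-Reasoning
    one : count (λ i → i == i₀) ≡ 1
    one = count-single (_== i₀) i₀ (==-refl i₀) (λ i t → ==→≡ t)
    ∧-true : ∀ b → b ∧ true ≡ b
    ∧-true true = refl
    ∧-true false = refl

  count-others₂ : ∀ {k} (i₀ i₁ : Fin k) → i₀ ≢ i₁ → count (λ i → not (i == i₀) ∧ not (i == i₁)) ≡ k ∸ 2
  count-others₂ {k} i₀ i₁ ne = begin
      count Both
    ≡⟨ sym (m+n∸n≡m _ 1) ⟩
      count Both + 1 ∸ 1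
    ≡⟨ cong (λ t → count Both + t ∸ 1) (sym one) ⟩
      count Both + count (λ i → not (i == i₀) ∧ (i == i₁)) ∸ 1
    ≡⟨ cong (_∸ 1) (+-comm (count Both) _) ⟩
      count (λ i → not (i == i₀) ∧ (i == i₁)) + count Both ∸ 1
    ≡⟨ cong (_∸ 1) (sym (trans (count-split (_== i₁) (λ i → not (i == i₀)))
          (cong₂ _+_ (count-ext (λ i → ∧-comm (i == i₁) _)) (count-ext (λ i → ∧-comm (not (i == i₁)) _))))) ⟩
      count (λ i → not (i == i₀)) ∸ 1
    ≡⟨ cong (_∸ 1) (count-others i₀) ⟩
      k ∸ 1 ∸ 1
    ≡⟨ ∸-+-assoc k 1 1 ⟩
      k ∸ 2
    ∎
    where
    open ≡-Reasoning
    Both : Fin k → Bool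
    Both i = not (i == i₀) ∧ not (i == i₁)
    one : count (λ i → not (i == i₀) ∧ (i == i₁)) ≡ 1
    one = count-single _ i₁ (∧-intro (not-intro (λ t → ne (sym (==→≡ t)))) (==-refl i₁))
                       (λ i t → ==→≡ (∧-elimʳ {not (i == i₀)} t))

  pairs-even : ∀ {k} (R : Fin k → Fin k → Bool) → (∀ i j → R i j ≡ R j i) → (∀ i → R i i ≡ false) →
               2 ∣ sum (λ i → count (R i))
  pairs-even {zero} R s r = divides 0 refl
  pairs-even {suc k} R s r with pairs-even (λ i j → R (suc i) (suc j)) (λ i j → s (suc i) (suc j)) (λ i → r (suc i))
  ... | divides q eq = divides (X + q) (begin
        (𝟙 (R zero zero) + X) + sum (λ i → 𝟙 (R (suc i) zero) + Y i)
      ≡⟨ cong (λ t → (𝟙 t + X) + sum (λ i → 𝟙 (R (suc i) zero) + Y i)) (r zero) ⟩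
        X + sum (λ i → 𝟙 (R (suc i) zero) + Y i)
      ≡⟨ cong (X +_) (∑-distrib-+ _ Y) ⟩
        X + (sum (λ i → 𝟙 (R (suc i) zero)) + sum Y)
      ≡⟨ cong (λ t → X + (t + sum Y)) (sum-cong-≗ (λ i → cong 𝟙 (s (suc i) zero))) ⟩
        X + (X + sum Y)
      ≡⟨ cong (λ t → X + (X + t)) eq ⟩
        X + (X + q * 2)
      ≡⟨ sym (+-assoc X X (q * 2)) ⟩
        X + X + q * 2
      ≡⟨ cong (_+ q * 2) (trans (cong (X +_) (sym (+-identityʳ X))) (*-comm 2 X)) ⟩
        X * 2 + q * 2
      ≡⟨ sym (*-distribʳ-+ 2 X q) ⟩
        (X + q) * 2
      ∎)
    where
    open ≡-Reasoning
    -- X counts the pairs (0, j+1), as many as the pairs (j+1, 0) by symmetry;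
    -- Y counts the pairs among the later indices.
    X = count (λ j → R zero (suc j))
    Y = λ i → count (λ j → R (suc i) (suc j))

  card≡count : ∀ {k} (p : Subset k) → ∣ p ∣ ≡ count (lookup p)
  card≡count [] = refl
  card≡count (true ∷ p) = cong suc (card≡count p)
  card≡count (false ∷ p) = card≡count p

module Arithmetic where
  open import Data.Nat.Divisibility using (∣m+n∣m⇒∣n; ∣m∣n⇒∣m+n; ∣⇒≤)
  open import Data.Nat.Primality using (prime?; euclidsLemma)
  open import Data.Nat.Tactic.RingSolver using (solve-∀)
  open import Relation.Nullary.Decidable using (from-yes)

  even-and-odd : ∀ m → 2 ∣ m → ¬ 2 ∣ suc m
  even-and-odd m 2∣m 2∣1+m = ¬2∣1 (∣m+n∣m⇒∣n (subst (2 ∣_) (+-comm 1 m) 2∣1+m) 2∣m)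
    where
    ¬2∣1 : ¬ 2 ∣ 1
    ¬2∣1 d with ∣⇒≤ d
    ... | s≤s ()

  consecutive-even : ∀ m → 2 ∣ m * suc m
  consecutive-even zero = divides 0 refl
  consecutive-even (suc m) = subst (2 ∣_) (step m) (∣m∣n⇒∣m+n (consecutive-even m) (divides (suc m) refl))
    where
    step : ∀ m → m * suc m + suc m * 2 ≡ suc m * suc (suc m)
    step = solve-∀

  even-n⇒odd : ∀ n w → 1 ≤ n → 2 ∣ n → 2 * (n ∸ 1) * suc n ≡ 2 * w → ¬ 2 ∣ w
  even-n⇒odd (suc m) w _ 2∣n e 2∣w
    with euclidsLemma m (suc (suc m)) (from-yes (prime? 2)) (subst (2 ∣_) (sym m*[m+2]≡w) 2∣w)
    where
    m*[m+2]≡w : m * suc (suc m) ≡ w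
    m*[m+2]≡w = *-cancelˡ-≡ (m * suc (suc m)) w 2 (trans (sym (*-assoc 2 m (suc (suc m)))) e)
  ... | inj₁ 2∣m = even-and-odd m 2∣m 2∣n
  ... | inj₂ 2∣m+2 = even-and-odd m (∣m+n∣m⇒∣n 2∣m+2 (divides 1 refl)) 2∣n

  even-n⇒odd-pred : ∀ n k → 1 ≤ n → 2 ∣ n → 2 ∣ k → k ≢ n ∸ 1
  even-n⇒odd-pred (suc m) k _ 2∣n 2∣k refl = even-and-odd m 2∣k 2∣n

  2[k-1]≰2[k-2] : ∀ k → 2 ≤ k → ¬ (2 * (k ∸ 1) ≤ 2 * (k ∸ 2))
  2[k-1]≰2[k-2] (suc (suc m)) _ le = 1+n≰n (*-cancelˡ-≤ 2 le)
  2[k-1]≰2[k-2] (suc zero) (s≤s ()) le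

  K+2≡2n : ∀ n → 1 ≤ n → 1 * (2 * (n ∸ 1)) + 2 * 1 ≡ 2 * n * 1
  K+2≡2n (suc m) _ = identity m
    where
    identity : ∀ m → 1 * (2 * m) + 2 * 1 ≡ 2 * suc m * 1
    identity = solve-∀

  2n≢K : ∀ n → 1 ≤ n → 2 * n ≢ 2 * (n ∸ 1)
  2n≢K (suc m) _ e = 1+n≰n (≤-reflexive (*-cancelˡ-≡ (suc m) m 2 e))

  two-values : ∀ n q → 2 * (n ∸ 1) ≤ 2 * q → 2 * q ≤ 2 * n → 2 * q ≡ 2 * (n ∸ 1) ⊎ 2 * q ≡ 2 * n
  two-values zero q _ hi with *-cancelˡ-≤ {q} {0} 2 hi
  ... | z≤n = inj₂ refl
  two-values (suc m) q lo hi with *-cancelˡ-≤ {m} {q} 2 lo | *-cancelˡ-≤ {q} {suc m} 2 hi | q Data.Nat.≟ suc m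
  ... | _ | _ | yes refl = inj₂ refl
  ... | m≤q | q≤1+m | no q≢1+m = inj₁ (cong (2 *_) (≤-antisym (s≤s⁻¹ (≤∧≢⇒< q≤1+m q≢1+m)) m≤q))

  -- The parity computation closing the case d(x,C) = 1: if S + 2k = 2n(n-1) and
  -- S + 2 = 2n + 2w + 2(n-1) then k + w = (n-1)(n-2), so k is even when w is.
  parity-of-k : ∀ n S k w → 2 ≤ n → S + 2 * k ≡ 2 * n * (n ∸ 1) → S + 2 ≡ 2 * n + 2 * w + (n ∸ 1) * 2 → 2 ∣ w → 2 ∣ k
  parity-of-k (suc zero) S k w (s≤s ()) E F 2∣w
  parity-of-k (suc (suc m)) S k w _ E F 2∣w =
    ∣m+n∣m⇒∣n (subst (2 ∣_) (trans k+w≡m[m+1] (+-comm k w)) (consecutive-even m)) 2∣w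
    where
    lhs : ∀ S k w m → (S + 2 * k) + (2 * suc (suc m) + 2 * w + suc m * 2) ≡ (S + (4 * m + 6)) + 2 * (k + w)
    lhs = solve-∀
    rhs : ∀ S m → 2 * suc (suc m) * suc m + (S + 2) ≡ (S + (4 * m + 6)) + 2 * (m * suc m)
    rhs = solve-∀
    combined : (S + (4 * m + 6)) + 2 * (k + w) ≡ (S + (4 * m + 6)) + 2 * (m * suc m)
    combined = trans (sym (lhs S k w m)) (trans (cong₂ _+_ E (sym F)) (rhs S m))
    k+w≡m[m+1] : m * suc m ≡ k + w
    k+w≡m[m+1] = sym (*-cancelˡ-≡ (k + w) (m * suc m) 2 (+-cancelˡ-≡ (S + (4 * m + 6)) _ _ combined))

module Rook where
  open Booleans

  Point : ℕ → Set
  Point n = Fin n × Fin n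

  Rook : ∀ {n} → Point n → Point n → Set
  Rook (i , j) (k , l) = (i ≡ k × j ≢ l) ⊎ (i ≢ k × j ≡ l)

  _≟ₚ_ : ∀ {n} (p q : Point n) → Dec (p ≡ q)
  _≟ₚ_ = ≡-dec _≟_ _≟_

  misaligned : ∀ {n} {i j k l : Fin n} → Rook (i , j) (k , l) → i ≢ k → j ≢ l → ⊥
  misaligned (inj₁ (e , _)) i≢k _ = i≢k e
  misaligned (inj₂ (_ , e)) _ j≢l = j≢l e

  two-elements⇒2≤k : ∀ {k} (i j : Fin k) → i ≢ j → 2 ≤ k
  two-elements⇒2≤k {suc zero} zero zero ne = ⊥-elim (ne refl)
  two-elements⇒2≤k {suc (suc k)} _ _ _ = s≤s (s≤s z≤n)

  two-cells⇒2≤n : ∀ {n} (p q : Point n) → p ≢ q → 2 ≤ n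
  two-cells⇒2≤n (a , b) (c , d) ne with a ≟ c
  ... | no a≢c = two-elements⇒2≤k a c a≢c
  ... | yes refl = two-elements⇒2≤k b d (λ e → ne (cong (a ,_) e))

  apart : ∀ {n} {p q : Point n} → ¬ Rook p q → p ≢ q → (proj₁ p ≢ proj₁ q) × (proj₂ p ≢ proj₂ q)
  apart {p = i , j} {k , l} nr ne with i ≟ k | j ≟ l
  ... | yes refl | yes refl = ⊥-elim (ne refl)
  ... | yes refl | no j≢l = ⊥-elim (nr (inj₁ (refl , j≢l)))
  ... | no i≢k | yes refl = ⊥-elim (nr (inj₂ (i≢k , refl)))
  ... | no i≢k | no j≢l = i≢k , j≢l

  common-neighbour-is-corner : ∀ {n} {P Q R : Point n} → ¬ Rook P Q → P ≢ Q → Rook R P → Rook R Q →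
                               R ≡ (proj₁ P , proj₂ Q) ⊎ R ≡ (proj₁ Q , proj₂ P)
  common-neighbour-is-corner {P = P} {Q} nr ne rp rq with apart {p = P} {Q} nr ne
  common-neighbour-is-corner _ _ (inj₁ (refl , _)) (inj₁ (refl , _)) | i≢k , _ = ⊥-elim (i≢k refl)
  common-neighbour-is-corner _ _ (inj₁ (refl , _)) (inj₂ (_ , refl)) | _ = inj₁ refl
  common-neighbour-is-corner _ _ (inj₂ (_ , refl)) (inj₁ (refl , _)) | _ = inj₂ refl
  common-neighbour-is-corner _ _ (inj₂ (_ , refl)) (inj₂ (_ , refl)) | _ , j≢l = ⊥-elim (j≢l refl)

  corners : ∀ {n} {P Q : Point n} → ¬ Rook P Q → P ≢ Q →
            Rook (proj₁ P , proj₂ Q) P × Rook (proj₁ P , proj₂ Q) Q ×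
            Rook (proj₁ Q , proj₂ P) P × Rook (proj₁ Q , proj₂ P) Q × ((proj₁ P , proj₂ Q) ≢ (proj₁ Q , proj₂ P))
  corners {P = P} {Q} nr ne with apart {p = P} {Q} nr ne
  ... | i≢k , j≢l = inj₁ (refl , λ e → j≢l (sym e)) , inj₂ (i≢k , refl) ,
                    inj₂ ((λ e → i≢k (sym e)) , refl) , inj₁ (refl , j≢l) , λ e → i≢k (cong proj₁ e)

  common-neighbours-nonadjacent : ∀ {n} {P Q R R' : Point n} → ¬ Rook P Q → P ≢ Q →
    Rook R P → Rook R Q → Rook R' P → Rook R' Q → R ≢ R' → ¬ Rook R R'
  common-neighbours-nonadjacent {P = P} {Q} nr ne r₁ r₂ r₁' r₂' d rr
    with apart {p = P} {Q} nr ne | common-neighbour-is-corner nr ne r₁ r₂ | common-neighbour-is-corner nr ne r₁' r₂'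
  ... | _ | inj₁ refl | inj₁ refl = d refl
  ... | _ | inj₂ refl | inj₂ refl = d refl
  ... | i≢k , j≢l | inj₁ refl | inj₂ refl = misaligned rr i≢k (λ e → j≢l (sym e))
  ... | i≢k , j≢l | inj₂ refl | inj₁ refl = misaligned rr (λ e → i≢k (sym e)) j≢l

  edge-point-common-neighbour : ∀ {n} {A A' P : Point n} → Rook A A' → ¬ Rook P A → ¬ Rook P A' → P ≢ A → P ≢ A' →
    Σ (Point n) λ R → Rook R P × Rook R A × Rook R A' × (∀ R' → Rook R' P → Rook R' A → Rook R' A' → R' ≡ R)
  edge-point-common-neighbour {A = a₁ , a₂} {_ , a₃} {p₁ , p₂} (inj₁ (refl , a₂≢a₃)) npa npa' nea nea'
    with apart {p = p₁ , p₂} {a₁ , a₂} npa nea | apart {p = p₁ , p₂} {a₁ , a₃} npa' nea'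
  ... | p₁≢a₁ , p₂≢a₂ | _ , p₂≢a₃ =
      (a₁ , p₂) , inj₂ ((λ e → p₁≢a₁ (sym e)) , refl) , inj₁ (refl , p₂≢a₂) , inj₁ (refl , p₂≢a₃) , unique
    where
    unique : ∀ R' → Rook R' (p₁ , p₂) → Rook R' (a₁ , a₂) → Rook R' (a₁ , a₃) → R' ≡ (a₁ , p₂)
    unique _ (inj₁ (e₁ , _)) (inj₁ (e₂ , _)) _ = ⊥-elim (p₁≢a₁ (trans (sym e₁) e₂))
    unique _ (inj₁ (e₁ , _)) (inj₂ _) (inj₁ (e₃ , _)) = ⊥-elim (p₁≢a₁ (trans (sym e₁) e₃))
    unique _ (inj₁ _) (inj₂ (_ , e₂)) (inj₂ (_ , e₃)) = ⊥-elim (a₂≢a₃ (trans (sym e₂) e₃))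
    unique _ (inj₂ (_ , e₁)) (inj₁ (e₂ , _)) _ = cong₂ _,_ e₂ e₁
    unique _ (inj₂ (_ , e₁)) (inj₂ (_ , e₂)) _ = ⊥-elim (p₂≢a₂ (trans (sym e₁) e₂))
  edge-point-common-neighbour {A = a₁ , a₂} {a₃ , _} {p₁ , p₂} (inj₂ (a₁≢a₃ , refl)) npa npa' nea nea'
    with apart {p = p₁ , p₂} {a₁ , a₂} npa nea | apart {p = p₁ , p₂} {a₃ , a₂} npa' nea'
  ... | p₁≢a₁ , p₂≢a₂ | p₁≢a₃ , _ =
      (p₁ , a₂) , inj₁ (refl , λ e → p₂≢a₂ (sym e)) , inj₂ (p₁≢a₁ , refl) , inj₂ (p₁≢a₃ , refl) , unique
    where
    unique : ∀ R' → Rook R' (p₁ , p₂) → Rook R' (a₁ , a₂) → Rook R' (a₃ , a₂) → R' ≡ (p₁ , a₂)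
    unique _ (inj₂ (_ , e₁)) (inj₂ (_ , e₂)) _ = ⊥-elim (p₂≢a₂ (trans (sym e₁) e₂))
    unique _ (inj₂ (_ , e₁)) (inj₁ _) (inj₂ (_ , e₃)) = ⊥-elim (p₂≢a₂ (trans (sym e₁) e₃))
    unique _ (inj₂ _) (inj₁ (e₂ , _)) (inj₁ (e₃ , _)) = ⊥-elim (a₁≢a₃ (trans (sym e₂) e₃))
    unique _ (inj₁ (e₁ , _)) (inj₂ (_ , e₂)) _ = cong₂ _,_ e₁ e₂
    unique _ (inj₁ (e₁ , _)) (inj₁ (e₂ , _)) _ = ⊥-elim (p₁≢a₁ (trans (sym e₁) e₂))

  rook-connected : ∀ {n} (A : Point n → Set) → (∀ p q → A p → Rook p q → A q) → ∀ p q → A p → A q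
  rook-connected A closed (i , j) (k , l) ap = along-column (along-row ap)
    where
    along-row : A (i , j) → A (i , l)
    along-row a with j ≟ l
    ... | yes refl = a
    ... | no j≢l = closed _ _ a (inj₁ (refl , j≢l))
    along-column : A (i , l) → A (k , l)
    along-column a with i ≟ k
    ... | yes refl = a
    ... | no i≢k = closed _ _ a (inj₂ (i≢k , refl))

  -- Lines (rows and columns) are the maximal cliques of the rook's graph.
  data Line (n : ℕ) : Set where
    row : Fin n → Line n
    col : Fin n → Line n

  OnLine : ∀ {n} → Line n → Point n → Set
  OnLine (row i) (a , _) = a ≡ i
  OnLine (col j) (_ , b) = b ≡ j

  onLine : ∀ {n} → Line n → Point n → Bool
  onLine (row i) (a , _) = a == i
  onLine (col j) (_ , b) = b == j

  onLine→ : ∀ {n} (ℓ : Line n) {p} → T (onLine ℓ p) → OnLine ℓ p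
  onLine→ (row i) t = ==→≡ t
  onLine→ (col j) t = ==→≡ t

  →onLine : ∀ {n} (ℓ : Line n) {p} → OnLine ℓ p → T (onLine ℓ p)
  →onLine (row i) e = ≡→== e
  →onLine (col j) e = ≡→== e

  line-clique : ∀ {n} (ℓ : Line n) {p q} → OnLine ℓ p → OnLine ℓ q → p ≢ q → Rook p q
  line-clique (row i) {_ , b} {_ , d} refl refl ne = inj₁ (refl , λ e → ne (cong (i ,_) e))
  line-clique (col j) {a , _} {c , _} refl refl ne = inj₂ ((λ e → ne (cong (_, j) e)) , refl)

  line-projection : ∀ {n} (ℓ : Line n) (r : Point n) → ¬ OnLine ℓ r →
    Σ (Point n) λ s → OnLine ℓ s × Rook s r × (∀ s' → OnLine ℓ s' → Rook s' r → s' ≡ s)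
  line-projection (row i) (a , b) off = (i , b) , refl , inj₂ ((λ e → off (sym e)) , refl) , unique
    where
    unique : ∀ s' → OnLine (row i) s' → Rook s' (a , b) → s' ≡ (i , b)
    unique _ refl (inj₁ (e , _)) = ⊥-elim (off (sym e))
    unique _ refl (inj₂ (_ , refl)) = refl
  line-projection (col j) (a , b) off = (a , j) , refl , inj₁ (refl , λ e → off (sym e)) , unique
    where
    unique : ∀ s' → OnLine (col j) s' → Rook s' (a , b) → s' ≡ (a , j)
    unique _ refl (inj₁ (refl , _)) = refl
    unique _ refl (inj₂ (_ , e)) = ⊥-elim (off (sym e))

  clique-within-line : ∀ {n} (Q : Point n → Bool) (p₀ : Point n) → T (Q p₀) →
    (∀ p q → T (Q p) → T (Q q) → p ≢ q → Rook p q) →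
    Σ (Line n) λ ℓ → OnLine ℓ p₀ × (∀ q → T (Q q) → OnLine ℓ q)
  clique-within-line {n} Q (i , j) q₀ clique with search {n} (λ a → any? (λ b → Q (a , b) ∧ not (a == i)))
  ... | inj₂ none = row i , refl , λ { (a , b) t → in-row a b t }
    where
    in-row : ∀ a b → T (Q (a , b)) → a ≡ i
    in-row a b t with a ≟ i
    ... | yes e = e
    ... | no a≢i = ⊥-elim (none a (any?-intro _ b (∧-intro t (not-intro (λ x → a≢i (==→≡ x))))))
  ... | inj₁ (a , t) with any?-elim _ t
  ... | b , t' = col j , refl , λ { (c , d) tq → in-column c d tq }
    where
    -- a cell (a , b) of the clique off the row of (i , j) forces the column of (i , j)
    qab : T (Q (a , b))
    qab = ∧-elimˡ t'
    a≢i : a ≢ i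
    a≢i e = not-elim (∧-elimʳ {Q (a , b)} t') (≡→== e)
    b≡j : b ≡ j
    b≡j with clique (a , b) (i , j) qab q₀ (λ e → a≢i (cong proj₁ e))
    ... | inj₁ (e , _) = ⊥-elim (a≢i e)
    ... | inj₂ (_ , e) = e
    in-column : ∀ c d → T (Q (c , d)) → d ≡ j
    in-column c d tq with d ≟ j
    ... | yes e = e
    ... | no d≢j with c ≟ i
    ...   | no c≢i with clique (c , d) (i , j) tq q₀ (λ e → c≢i (cong proj₁ e))
    ...     | inj₁ (e , _) = ⊥-elim (c≢i e)
    ...     | inj₂ (_ , e) = ⊥-elim (d≢j e)
    in-column c d tq | no d≢j | yes refl with clique (c , d) (a , b) tq qab (λ e → a≢i (sym (cong proj₁ e)))
    ... | inj₁ (e , _) = ⊥-elim (a≢i (sym e))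
    ... | inj₂ (_ , e) = ⊥-elim (d≢j (trans e b≡j))

module CellCount where
  open Booleans
  open Counting
  open Rook

  gsum : ∀ {n} → (Point n → ℕ) → ℕ
  gsum f = sum (λ i → sum (λ j → f (i , j)))

  gcount : ∀ {n} → (Point n → Bool) → ℕ
  gcount g = gsum (λ p → 𝟙 (g p))

  gsum-ext : ∀ {n} {f g : Point n → ℕ} → (∀ p → f p ≡ g p) → gsum f ≡ gsum g
  gsum-ext h = sum-cong-≗ (λ i → sum-cong-≗ (λ j → h (i , j)))

  gcount-ext : ∀ {n} {f g : Point n → Bool} → (∀ p → f p ≡ g p) → gcount f ≡ gcount g
  gcount-ext h = gsum-ext (λ p → cong 𝟙 (h p))

  gcount-ext⇔ : ∀ {n} {f g : Point n → Bool} → (∀ p → T (f p) → T (g p)) → (∀ p → T (g p) → T (f p)) →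
                gcount f ≡ gcount g
  gcount-ext⇔ h h' = gcount-ext (λ p → T-ext (h p) (h' p))

  gsum-+ : ∀ {n} (f g : Point n → ℕ) → gsum (λ p → f p + g p) ≡ gsum f + gsum g
  gsum-+ f g = trans (sum-cong-≗ (λ i → ∑-distrib-+ (λ j → f (i , j)) (λ j → g (i , j))))
                     (∑-distrib-+ (λ i → sum (λ j → f (i , j))) (λ i → sum (λ j → g (i , j))))

  gsum-zero : ∀ {n} {f : Point n → ℕ} → (∀ p → f p ≡ 0) → gsum f ≡ 0
  gsum-zero h = sum-zero (λ i → sum-zero (λ j → h (i , j)))

  gsum-single : ∀ {n} (p₀ : Point n) (f : Point n → ℕ) → (∀ p → p ≢ p₀ → f p ≡ 0) → gsum f ≡ f p₀
  gsum-single (i₀ , j₀) f h =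
    trans (sum-single i₀ _ (λ i ne → sum-zero (λ j → h (i , j) (λ e → ne (cong proj₁ e)))))
          (sum-single j₀ _ (λ j ne → h (i₀ , j) (λ e → ne (cong proj₂ e))))

  gcount-line : ∀ {n} (ℓ : Line n) → gcount (onLine ℓ) ≡ n
  gcount-line {n} (row i) =
    trans (sum-single {n} i (λ a → count {n} (λ b → a == i)) (λ a ne → count-none {n} (λ b → a == i) (λ b t → ne (==→≡ t))))
          (trans (count-ext {n} {λ _ → i == i} {λ _ → true} (λ b → T-true (==-refl i))) (count-all {n}))
  gcount-line {n} (col j) =
    trans (sum-cong-≗ {n} {x = λ a → count (λ b → b == j)} {y = λ _ → 1} (λ a → count-single _ j (==-refl j) (λ b t → ==→≡ t)))
          (count-all {n})

  swap : ∀ {n} → Point n → Point n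
  swap (i , j) = (j , i)

  swap-injective : ∀ {n} {p q : Point n} → swap p ≡ swap q → p ≡ q
  swap-injective {p = _ , _} {_ , _} refl = refl

  rook-swap : ∀ {n} {p q : Point n} → Rook p q → Rook (swap p) (swap q)
  rook-swap (inj₁ (a , b)) = inj₂ (b , a)
  rook-swap (inj₂ (a , b)) = inj₁ (b , a)

  gcount-swap : ∀ {n} (g : Point n → Bool) → gcount (λ p → g (swap p)) ≡ gcount g
  gcount-swap g = ∑-comm (λ i j → 𝟙 (g (j , i)))

  count-zero-or-two : ∀ {k} (h : Fin k → Bool) →
     (∀ j j₁ j₂ → T (h j) → T (h j₁) → T (h j₂) → j₁ ≢ j → j₂ ≢ j → j₁ ≡ j₂) →
     (∀ j → T (h j) → ∃ λ j' → j' ≢ j × T (h j')) →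
     count h ≡ 2 * 𝟙 (any? h)
  count-zero-or-two h at-most-two partner with search h
  ... | inj₂ none = trans (count-none h none)
                          (cong (λ b → 2 * 𝟙 b) (sym (¬T-false (λ t → let (i , tᵢ) = any?-elim h t in none i tᵢ))))
  ... | inj₁ (j , tj) with partner j tj
  ... | j' , j'≢j , tj' = begin
        count h
      ≡⟨ count-split (_== j) h ⟩
        count (λ t → (t == j) ∧ h t) + count (λ t → not (t == j) ∧ h t)
      ≡⟨ cong₂ _+_ (count-single _ j (∧-intro (==-refl j) tj) (λ t u → ==→≡ (∧-elimˡ u)))
                   (count-single _ j' (∧-intro (not-intro (λ e → j'≢j (==→≡ e))) tj')
                      (λ t u → at-most-two j t j' tj (∧-elimʳ {not (t == j)} u) tj'
                                           (λ e → not-elim (∧-elimˡ u) (≡→== e)) j'≢j)) ⟩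
        2
      ≡⟨ cong (λ b → 2 * 𝟙 b) (sym (T-true (any?-intro h j tj))) ⟩
        2 * 𝟙 (any? h)
      ∎
    where open ≡-Reasoning

  RowPairs : ∀ {n} → (Point n → Bool) → Set
  RowPairs {n} g =
    (∀ i j j₁ j₂ → T (g (i , j)) → T (g (i , j₁)) → T (g (i , j₂)) → j₁ ≢ j → j₂ ≢ j → j₁ ≡ j₂) ×
    (∀ i j → T (g (i , j)) → ∃ λ j' → j' ≢ j × T (g (i , j')))

  occupiedRow : ∀ {n} → (Point n → Bool) → Fin n → Bool
  occupiedRow g i = any? (λ j → g (i , j))

  EmptyRow : ∀ {n} → (Point n → Bool) → Fin n → Set
  EmptyRow g i = ∀ j → ¬ T (g (i , j))

  gcount-rows : ∀ {n} (g : Point n → Bool) → RowPairs g → gcount g ≡ 2 * count (occupiedRow g)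
  gcount-rows g (at-most-two , partner) =
    trans (sum-cong-≗ (λ i → count-zero-or-two (λ j → g (i , j)) (at-most-two i) (partner i)))
          (sym (*-distribˡ-sum 2 (λ i → 𝟙 (occupiedRow g i))))

  occupied-rows-bound : ∀ {n} (g : Point n → Bool) (allowed : Fin n → Bool) → (∀ i → ¬ T (allowed i) → EmptyRow g i) →
                        RowPairs g → gcount g ≤ 2 * count allowed
  occupied-rows-bound g allowed empty rp =
    ≤-trans (≤-reflexive (gcount-rows g rp)) (*-monoʳ-≤ 2 (count-mono occupied⇒allowed))
    where
    occupied⇒allowed : ∀ i → T (occupiedRow g i) → T (allowed i)
    occupied⇒allowed i t with allowed i in e
    ... | true = tt
    ... | false = let (j , tj) = any?-elim _ t in empty i (λ a → subst T e a) j tj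

  gcount-even : ∀ {n} (g : Point n → Bool) → RowPairs g → ∃ λ q → gcount g ≡ 2 * q
  gcount-even g rp = count (occupiedRow g) , gcount-rows g rp

  gcount≤2n : ∀ {n} (g : Point n → Bool) → RowPairs g → gcount g ≤ 2 * n
  gcount≤2n {n} g rp = ≤-trans (occupied-rows-bound g (λ _ → true) (λ i f → ⊥-elim (f tt)) rp)
                               (≤-reflexive (cong (2 *_) (count-all {n})))

  gcount-one-empty : ∀ {n} (g : Point n → Bool) → RowPairs g → ∀ i₀ → EmptyRow g i₀ → gcount g ≤ 2 * (n ∸ 1)
  gcount-one-empty g rp i₀ e =
    ≤-trans (occupied-rows-bound g (λ i → not (i == i₀)) empty rp) (≤-reflexive (cong (2 *_) (count-others i₀)))
    where
    empty : ∀ i → ¬ T (not (i == i₀)) → EmptyRow g i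
    empty i t = subst (EmptyRow g) (sym (==→≡ (not-not t))) e

  gcount-two-empty : ∀ {n} (g : Point n → Bool) → RowPairs g → ∀ i₀ i₁ → i₀ ≢ i₁ → EmptyRow g i₀ → EmptyRow g i₁ →
                     gcount g ≤ 2 * (n ∸ 2)
  gcount-two-empty g rp i₀ i₁ ne e₀ e₁ =
    ≤-trans (occupied-rows-bound g (λ i → not (i == i₀) ∧ not (i == i₁)) empty rp)
            (≤-reflexive (cong (2 *_) (count-others₂ i₀ i₁ ne)))
    where
    empty : ∀ i → ¬ T (not (i == i₀) ∧ not (i == i₁)) → EmptyRow g i
    empty i t with ¬∧ {not (i == i₀)} t
    ... | inj₁ t₀ = subst (EmptyRow g) (sym (==→≡ (not-not t₀))) e₀
    ... | inj₂ t₁ = subst (EmptyRow g) (sym (==→≡ (not-not t₁))) e₁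

  -- The shape of a μ-graph seen inside a local grid: within the set, neighbours of a common
  -- cell are pairwise nonadjacent, and every cell has two such (nonadjacent) neighbours.
  MuShape : ∀ {n} → (Point n → Bool) → Set
  MuShape {n} g =
    (∀ r s s' → T (g r) → T (g s) → T (g s') → Rook r s → Rook r s' → s ≢ s' → ¬ Rook s s') ×
    (∀ r → T (g r) → Σ (Point n) λ s₁ → Σ (Point n) λ s₂ →
       T (g s₁) × T (g s₂) × Rook r s₁ × Rook r s₂ × s₁ ≢ s₂ × ¬ Rook s₁ s₂)

  MuShape→RowPairs : ∀ {n} (g : Point n → Bool) → MuShape g → RowPairs g
  MuShape→RowPairs g (independent , two-neighbours) = at-most-two , partner
    where
    at-most-two : ∀ i j j₁ j₂ → T (g (i , j)) → T (g (i , j₁)) → T (g (i , j₂)) → j₁ ≢ j → j₂ ≢ j → j₁ ≡ j₂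
    at-most-two i j j₁ j₂ t t₁ t₂ n₁ n₂ with j₁ ≟ j₂
    ... | yes e = e
    ... | no ne = ⊥-elim (independent (i , j) (i , j₁) (i , j₂) t t₁ t₂
                            (inj₁ (refl , λ e → n₁ (sym e))) (inj₁ (refl , λ e → n₂ (sym e)))
                            (λ e → ne (cong proj₂ e)) (inj₁ (refl , ne)))
    -- of two nonadjacent neighbours of (i , j), at most one lies in its column
    partner : ∀ i j → T (g (i , j)) → ∃ λ j' → j' ≢ j × T (g (i , j'))
    partner i j t with two-neighbours (i , j) t
    ... | (_ , b₁) , _ , t₁ , _ , inj₁ (e , nb) , _ , _ , _ = b₁ , (λ x → nb (sym x)) , subst (λ z → T (g (z , b₁))) (sym e) t₁
    ... | _ , (_ , b₂) , _ , t₂ , _ , inj₁ (e , nb) , _ , _ = b₂ , (λ x → nb (sym x)) , subst (λ z → T (g (z , b₂))) (sym e) t₂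
    ... | _ , _ , _ , _ , inj₂ (_ , e₁) , inj₂ (_ , e₂) , ne , nr =
          ⊥-elim (nr (inj₂ ((λ x → ne (cong₂ _,_ x (trans (sym e₁) e₂))) , trans (sym e₁) e₂)))

  MuShape-swap : ∀ {n} (g : Point n → Bool) → MuShape g → MuShape (λ p → g (swap p))
  MuShape-swap g (independent , two-neighbours) =
    (λ r s s' t ts ts' rs rs' ne nr → independent (swap r) (swap s) (swap s') t ts ts' (rook-swap rs) (rook-swap rs')
                                        (λ e → ne (swap-injective e)) (rook-swap nr)) ,
    (λ r t → let (s₁ , s₂ , t₁ , t₂ , r₁ , r₂ , ne , nr) = two-neighbours (swap r) t in
       swap s₁ , swap s₂ , t₁ , t₂ , rook-swap r₁ , rook-swap r₂ , (λ e → ne (swap-injective e)) , λ x → nr (rook-swap x))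

  empty-line-bound : ∀ {n} (g : Point n → Bool) → MuShape g → ∀ ℓ → (∀ p → OnLine ℓ p → ¬ T (g p)) →
                     gcount g ≤ 2 * (n ∸ 1)
  empty-line-bound g mu (row i) e = gcount-one-empty g (MuShape→RowPairs g mu) i (λ j → e (i , j) refl)
  empty-line-bound g mu (col j) e =
    ≤-trans (≤-reflexive (sym (gcount-swap g)))
            (gcount-one-empty (λ p → g (swap p)) (MuShape→RowPairs _ (MuShape-swap g mu)) j (λ t → e (t , j) refl))

  AvoidsCross : ∀ {n} → (Point n → Bool) → Point n → Set
  AvoidsCross g r = ∀ p → (p ≡ r ⊎ Rook p r) → ¬ T (g p)

  -- A μ-shaped set avoiding the crosses of two distinct cells has at most 2(n-2) cells:
  -- the two crosses cover two rows or two columns.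
  two-crosses-bound : ∀ {n} (g : Point n → Bool) → MuShape g → ∀ r r' → r ≢ r' → AvoidsCross g r → AvoidsCross g r' →
                      gcount g ≤ 2 * (n ∸ 2)
  two-crosses-bound g mu (a , b) (c , d) ne cr cr' with a ≟ c
  ... | no a≢c = gcount-two-empty g (MuShape→RowPairs g mu) a c a≢c (row-empty cr) (row-empty cr')
    where
    row-empty : ∀ {a b} → AvoidsCross g (a , b) → EmptyRow g a
    row-empty {a} {b} cr t with t ≟ b
    ... | yes refl = cr (a , t) (inj₁ refl)
    ... | no t≢b = cr (a , t) (inj₂ (inj₁ (refl , t≢b)))
  ... | yes refl =
      ≤-trans (≤-reflexive (sym (gcount-swap g)))
              (gcount-two-empty (λ p → g (swap p)) (MuShape→RowPairs _ (MuShape-swap g mu)) b d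
                                (λ e → ne (cong (a ,_) e)) (column-empty cr) (column-empty cr'))
    where
    column-empty : ∀ {a b} → AvoidsCross g (a , b) → EmptyRow (λ p → g (swap p)) b
    column-empty {a} {b} cr t with t ≟ a
    ... | yes refl = cr (t , b) (inj₁ refl)
    ... | no t≢a = cr (t , b) (inj₂ (inj₂ (t≢a , refl)))

  rook? : ∀ {n} → Point n → Point n → Bool
  rook? (i , j) (k , l) = ((i == k) ∧ not (j == l)) ∨ (not (i == k) ∧ (j == l))

  rook→rook? : ∀ {n} {p q : Point n} → Rook p q → T (rook? p q)
  rook→rook? {p = i , j} {k , l} (inj₁ (refl , j≢l)) rewrite ≢→== j≢l | T-true (==-refl i) = tt
  rook→rook? {p = i , j} {k , l} (inj₂ (i≢k , refl)) rewrite ≢→== i≢k | T-true (==-refl j) = tt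

  rook?→rook : ∀ {n} {p q : Point n} → T (rook? p q) → Rook p q
  rook?→rook {p = i , j} {k , l} t with i == k in e₁ | j == l in e₂
  ... | true | false = inj₁ (==→≡ (true-T e₁) , λ e → subst T e₂ (≡→== e))
  ... | false | true = inj₂ ((λ e → subst T e₁ (≡→== e)) , ==→≡ (true-T e₂))

  -- For adjacent cells A, B, exactly 2n cells are adjacent to exactly one of them:
  -- these are the cells of the two lines through A and B orthogonal to the line AB.
  gcount-xor : ∀ {n} (A B : Point n) → Rook A B → gcount (λ p → rook? A p xor rook? B p) ≡ 2 * n
  gcount-xor {n} (i , j) (_ , l) (inj₁ (refl , j≢l)) = begin
      gcount (λ p → rook? (i , j) p xor rook? (i , l) p)
    ≡⟨ gsum-ext (λ { (s , t) → trans (xor-columns (i == s) (j == t) (l == t) (λ x y → j≢l (trans (==→≡ x) (sym (==→≡ y)))))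
                                     (cong₂ _+_ (cong 𝟙 (==-sym j t)) (cong 𝟙 (==-sym l t))) }) ⟩
      gsum (λ p → 𝟙 (onLine (col j) p) + 𝟙 (onLine (col l) p))
    ≡⟨ gsum-+ (λ p → 𝟙 (onLine (col j) p)) (λ p → 𝟙 (onLine (col l) p)) ⟩
      gcount (onLine (col j)) + gcount (onLine (col l))
    ≡⟨ cong₂ _+_ (gcount-line (col j)) (gcount-line (col l)) ⟩
      n + n
    ≡⟨ cong (n +_) (sym (+-identityʳ n)) ⟩
      2 * n
    ∎
    where
    open ≡-Reasoning
    xor-columns : ∀ e f f' → (T f → T f' → ⊥) →
                  𝟙 (((e ∧ not f) ∨ (not e ∧ f)) xor ((e ∧ not f') ∨ (not e ∧ f'))) ≡ 𝟙 f + 𝟙 f'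
    xor-columns true true true h = ⊥-elim (h tt tt)
    xor-columns false true true h = ⊥-elim (h tt tt)
    xor-columns true true false h = refl
    xor-columns true false true h = refl
    xor-columns true false false h = refl
    xor-columns false true false h = refl
    xor-columns false false true h = refl
    xor-columns false false false h = refl
  gcount-xor {n} (i , j) (k , _) (inj₂ (i≢k , refl)) = begin
      gcount (λ p → rook? (i , j) p xor rook? (k , j) p)
    ≡⟨ gsum-ext (λ { (s , t) → trans (xor-rows (j == t) (i == s) (k == s) (λ x y → i≢k (trans (==→≡ x) (sym (==→≡ y)))))
                                     (cong₂ _+_ (cong 𝟙 (==-sym i s)) (cong 𝟙 (==-sym k s))) }) ⟩
      gsum (λ p → 𝟙 (onLine (row i) p) + 𝟙 (onLine (row k) p))
    ≡⟨ gsum-+ (λ p → 𝟙 (onLine (row i) p)) (λ p → 𝟙 (onLine (row k) p)) ⟩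
      gcount (onLine (row i)) + gcount (onLine (row k))
    ≡⟨ cong₂ _+_ (gcount-line (row i)) (gcount-line (row k)) ⟩
      n + n
    ≡⟨ cong (n +_) (sym (+-identityʳ n)) ⟩
      2 * n
    ∎
    where
    open ≡-Reasoning
    xor-rows : ∀ e f f' → (T f → T f' → ⊥) →
               𝟙 (((f ∧ not e) ∨ (not f ∧ e)) xor ((f' ∧ not e) ∨ (not f' ∧ e))) ≡ 𝟙 f + 𝟙 f'
    xor-rows true true true h = ⊥-elim (h tt tt)
    xor-rows false true true h = ⊥-elim (h tt tt)
    xor-rows true true false h = refl
    xor-rows true false true h = refl
    xor-rows true false false h = refl
    xor-rows false true false h = refl
    xor-rows false false true h = refl
    xor-rows false false false h = refl

  any-cell? : ∀ {n} → (Point n → Bool) → Bool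
  any-cell? g = any? (λ i → any? (λ j → g (i , j)))

  any-cell?-intro : ∀ {n} (g : Point n → Bool) p → T (g p) → T (any-cell? g)
  any-cell?-intro g (i , j) t = any?-intro _ i (any?-intro (λ j → g (i , j)) j t)

  any-cell?-elim : ∀ {n} (g : Point n → Bool) → T (any-cell? g) → ∃ λ p → T (g p)
  any-cell?-elim g t = let (i , t₁) = any?-elim _ t ; (j , t₂) = any?-elim _ t₁ in (i , j) , t₂

module Distances (G : Graph) where
  open Booleans
  open Graph G using (adj)

  _~_ : V G → V G → Set
  x ~ y = Adj G x y

  ~-sym : ∀ {x y} → x ~ y → y ~ x
  ~-sym {x} {y} h = subst T (Graph.sym G x y) h

  ~-irrefl : ∀ {x} → ¬ x ~ x
  ~-irrefl {x} h = subst T (Graph.irrefl G x) h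

  ~-≢ : ∀ {x y} → x ~ y → x ≢ y
  ~-≢ h refl = ~-irrefl h

  dist-refl : ∀ {x} → DistLe G x x 0
  dist-refl = 0 , z≤n , nil

  dist-mono : ∀ {x y k k'} → k ≤ k' → DistLe G x y k → DistLe G x y k'
  dist-mono le (m , m≤k , w) = m , ≤-trans m≤k le , w

  dist-cons : ∀ {x z y k} → x ~ z → DistLe G z y k → DistLe G x y (suc k)
  dist-cons h (m , m≤k , w) = suc m , s≤s m≤k , cons h w

  dist-snoc : ∀ {x y w k} → DistLe G x y k → y ~ w → DistLe G x w (suc k)
  dist-snoc (m , m≤k , walk) h = suc m , s≤s m≤k , snoc walk h
    where
    snoc : ∀ {x y w k} → Walk G x y k → y ~ w → Walk G x w (suc k)
    snoc nil h = cons h nil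
    snoc (cons h' w) h = cons h' (snoc w h)

  dist-1 : ∀ {x y} → x ~ y → DistLe G x y 1
  dist-1 h = dist-cons h dist-refl

  dist-2 : ∀ {x z y} → x ~ z → z ~ y → DistLe G x y 2
  dist-2 h h' = dist-cons h (dist-1 h')

  dist-0-elim : ∀ {x y} → DistLe G x y 0 → x ≡ y
  dist-0-elim (zero , _ , nil) = refl

  dist-suc-elim : ∀ {x y k} → DistLe G x y (suc k) → x ≡ y ⊎ ∃ λ z → x ~ z × DistLe G z y k
  dist-suc-elim (zero , _ , nil) = inj₁ refl
  dist-suc-elim (suc m , s≤s m≤k , cons h w) = inj₂ (_ , h , m , m≤k , w)

  dist-1-elim : ∀ {x y} → DistLe G x y 1 → x ≡ y ⊎ x ~ y
  dist-1-elim d with dist-suc-elim d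
  ... | inj₁ e = inj₁ e
  ... | inj₂ (z , h , d') with dist-0-elim d'
  ...   | refl = inj₂ h

  dist-2-elim : ∀ {x y} → DistLe G x y 2 → x ≡ y ⊎ x ~ y ⊎ ∃ λ z → x ~ z × z ~ y
  dist-2-elim d with dist-suc-elim d
  ... | inj₁ e = inj₁ e
  ... | inj₂ (z , h , d') with dist-1-elim d'
  ...   | inj₁ refl = inj₂ (inj₁ h)
  ...   | inj₂ h' = inj₂ (inj₂ (z , h , h'))

  dist-3-elim : ∀ {x u} → DistLe G x u 3 → ¬ DistLe G x u 2 → ∃ λ b → DistLe G x b 2 × b ~ u
  dist-3-elim d nd with dist-suc-elim d
  ... | inj₁ refl = ⊥-elim (nd (dist-mono z≤n dist-refl))
  ... | inj₂ (a , xa , da) with dist-2-elim da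
  ...   | inj₁ refl = ⊥-elim (nd (dist-mono (s≤s z≤n) (dist-1 xa)))
  ...   | inj₂ (inj₁ ab) = ⊥-elim (nd (dist-2 xa ab))
  ...   | inj₂ (inj₂ (b , ab , bu)) = b , dist-2 xa ab , bu

  dist≤2? : ∀ x y → Dec (DistLe G x y 2)
  dist≤2? x y with (x == y) ∨ (adj x y ∨ any? (λ z → adj x z ∧ adj z y)) in e
  ... | true = yes (from-bool (true-T e))
    where
    from-bool : T ((x == y) ∨ (adj x y ∨ any? (λ z → adj x z ∧ adj z y))) → DistLe G x y 2
    from-bool t with ∨-elim {x == y} t
    ... | inj₁ t₁ = subst (λ v → DistLe G x v 2) (==→≡ t₁) (dist-mono z≤n dist-refl)
    ... | inj₂ t₂ with ∨-elim {adj x y} t₂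
    ...   | inj₁ h = dist-mono (s≤s z≤n) (dist-1 h)
    ...   | inj₂ t₃ = let (z , tz) = any?-elim _ t₃ in dist-2 (∧-elimˡ tz) (∧-elimʳ {adj x z} tz)
  ... | false = no (λ d → subst T e (to-bool d))
    where
    to-bool : DistLe G x y 2 → T ((x == y) ∨ (adj x y ∨ any? (λ z → adj x z ∧ adj z y)))
    to-bool d with dist-2-elim d
    ... | inj₁ refl = ∨-introˡ (==-refl x)
    ... | inj₂ (inj₁ h) = ∨-introʳ {x == y} (∨-introˡ h)
    ... | inj₂ (inj₂ (z , h , h')) = ∨-introʳ {x == y} (∨-introʳ {adj x y} (any?-intro _ z (∧-intro h h')))

  dist2-intro : ∀ {x z y} → x ≢ y → ¬ x ~ y → x ~ z → z ~ y → Dist G x y 2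
  dist2-intro {x} {z} {y} ne na h h' = dist-2 h h' , shorter
    where
    shorter : ∀ m → m < 2 → ¬ DistLe G x y m
    shorter zero _ d = ne (dist-0-elim d)
    shorter (suc zero) _ d = [ ne , na ]′ (dist-1-elim d)
    shorter (suc (suc m)) (s≤s (s≤s ()))

  dist2-elim : ∀ {x y} → Dist G x y 2 → x ≢ y × ¬ x ~ y × ∃ λ z → x ~ z × z ~ y
  dist2-elim {x} {y} (d , shorter) with dist-2-elim d
  ... | inj₁ e = ⊥-elim (distinct e)
    where
    distinct : x ≢ y
    distinct e = shorter 0 (s≤s z≤n) (subst (λ t → DistLe G x t 0) e dist-refl)
  ... | inj₂ (inj₁ h) = ⊥-elim (shorter 1 (s≤s (s≤s z≤n)) (dist-1 h))
  ... | inj₂ (inj₂ mid) = (λ e → shorter 0 (s≤s z≤n) (subst (λ t → DistLe G x t 0) e dist-refl)) ,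
                          (λ h → shorter 1 (s≤s (s≤s z≤n)) (dist-1 h)) , mid

  dist2? : V G → V G → Bool
  dist2? x y = not (x == y) ∧ (not (adj x y) ∧ any? (λ z → adj x z ∧ adj z y))

  dist2?→dist2 : ∀ {x y} → T (dist2? x y) → Dist G x y 2
  dist2?→dist2 {x} {y} t =
    let t₁ = ∧-elimʳ {not (x == y)} t ; t₂ = ∧-elimʳ {not (adj x y)} t₁ ; (z , tz) = any?-elim _ t₂ in
    dist2-intro (λ e → not-elim (∧-elimˡ t) (≡→== e)) (not-elim (∧-elimˡ t₁)) (∧-elimˡ tz) (∧-elimʳ {adj x z} tz)

  dist2→dist2? : ∀ {x y} → Dist G x y 2 → T (dist2? x y)
  dist2→dist2? d with dist2-elim d
  ... | ne , na , z , h , h' = ∧-intro (not-intro (λ e → ne (==→≡ e))) (∧-intro (not-intro na) (any?-intro _ z (∧-intro h h')))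

module CommonNeighbours (G : Graph) where
  open Counting
  open Graph G using (adj)

  c₂-count : ∀ x y → c₂ G x y ≡ count (λ z → adj x z ∧ adj y z)
  c₂-count x y = trans (card≡count (common G x y)) (count-ext (lookup∘tabulate (λ z → adj x z ∧ adj y z)))

  -- Counting paths x ~ u ~ z with z in F in two ways:
  -- Σ_{z ∈ F} c₂(x,z) = Σ_{u ∈ Γ(x)} |Γ(u) ∩ F|.
  double-count : ∀ x (F : V G → Bool) →
    sum (λ z → 𝟙 (F z) * c₂ G x z) ≡ sum (λ u → 𝟙 (adj x u) * count (λ z → F z ∧ adj z u))
  double-count x F = begin
      sum (λ z → 𝟙 (F z) * c₂ G x z)
    ≡⟨ sum-cong-≗ (λ z → trans (cong (𝟙 (F z) *_) (c₂-count x z)) (𝟙-*-count (F z) (λ u → adj x u ∧ adj z u))) ⟩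
      sum (λ z → count (λ u → F z ∧ (adj x u ∧ adj z u)))
    ≡⟨ ∑-comm (λ z u → 𝟙 (F z ∧ (adj x u ∧ adj z u))) ⟩
      sum (λ u → count (λ z → F z ∧ (adj x u ∧ adj z u)))
    ≡⟨ sum-cong-≗ (λ u → trans (count-ext (λ z → rearrange (F z) (adj x u) (adj z u)))
                               (sym (𝟙-*-count (adj x u) (λ z → F z ∧ adj z u)))) ⟩
      sum (λ u → 𝟙 (adj x u) * count (λ z → F z ∧ adj z u))
    ∎
    where
    open ≡-Reasoning
    rearrange : ∀ f p q → f ∧ (p ∧ q) ≡ p ∧ (f ∧ q)
    rearrange true true q = refl
    rearrange true false q = refl
    rearrange false true q = refl
    rearrange false false q = refl

module LocalGrid (G : Graph) (n : ℕ) (lg : LocallyGrid G n) where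
  open Booleans
  open Counting
  open Rook
  open CellCount
  open Distances G
  open Graph G using (adj)

  module _ (x : V G) where
    private
      module F = Inverse (proj₁ (lg x))

    at : Point n → V G
    at p = proj₁ (F.to p)

    at-adj : ∀ p → x ~ at p
    at-adj p = proj₂ (F.to p)

    cell : ∀ v → x ~ v → Point n
    cell v h = F.from (v , h)

    at-cell : ∀ v h → at (cell v h) ≡ v
    at-cell v h = cong proj₁ (F.strictlyInverseˡ (v , h))

    cell-at : ∀ p h → cell (at p) h ≡ p
    cell-at p h = trans (cong (λ h' → F.from (at p , h')) (T-irrelevant h (at-adj p))) (F.strictlyInverseʳ p)

    at-injective : ∀ {p q} → at p ≡ at q → p ≡ q
    at-injective {p} {q} e = trans (sym (cell-at p (at-adj p))) (trans (cell-cong e) (cell-at q (at-adj q)))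
      where
      cell-cong : ∀ {v w} (e : v ≡ w) {h h'} → cell v h ≡ cell w h'
      cell-cong refl {h} {h'} = cong (cell _) (T-irrelevant h h')

    cell-injective : ∀ {v w} (hv : x ~ v) (hw : x ~ w) → cell v hv ≡ cell w hw → v ≡ w
    cell-injective {v} {w} hv hw e = trans (sym (at-cell v hv)) (trans (cong at e) (at-cell w hw))

    rook→~ : ∀ {p q} → Rook p q → at p ~ at q
    rook→~ {p} {q} = Equivalence.from (proj₂ (lg x) p q)

    ~→rook : ∀ {p q} → at p ~ at q → Rook p q
    ~→rook {p} {q} = Equivalence.to (proj₂ (lg x) p q)

    ~→rook-cell : ∀ {v w} (hv : x ~ v) (hw : x ~ w) → v ~ w → Rook (cell v hv) (cell w hw)
    ~→rook-cell {v} {w} hv hw h = ~→rook (subst₂ _~_ (sym (at-cell v hv)) (sym (at-cell w hw)) h)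

    rook-cell→~ : ∀ {v w} (hv : x ~ v) (hw : x ~ w) → Rook (cell v hv) (cell w hw) → v ~ w
    rook-cell→~ {v} {w} hv hw r = subst₂ _~_ (at-cell v hv) (at-cell w hw) (rook→~ r)

    adj-at : ∀ p q → adj (at p) (at q) ≡ rook? p q
    adj-at p q = T-ext (λ h → rook→rook? (~→rook h)) (λ t → rook→~ (rook?→rook t))

  count-neighbours : ∀ y (Q : V G → Bool) → count (λ z → adj y z ∧ Q z) ≡ gcount (λ p → Q (at y p))
  count-neighbours y Q = begin
      count (λ z → adj y z ∧ Q z)
    ≡⟨ sum-cong-≗ spread ⟩
      sum (λ z → sum (λ i → sum (λ j → 𝟙 ((at y (i , j) == z) ∧ Q z))))
    ≡⟨ ∑-comm (λ z i → sum (λ j → 𝟙 ((at y (i , j) == z) ∧ Q z))) ⟩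
      sum (λ i → sum (λ z → sum (λ j → 𝟙 ((at y (i , j) == z) ∧ Q z))))
    ≡⟨ sum-cong-≗ (λ i → ∑-comm (λ z j → 𝟙 ((at y (i , j) == z) ∧ Q z))) ⟩
      gsum (λ p → count (λ z → (at y p == z) ∧ Q z))
    ≡⟨ gsum-ext (λ p → trans (count-at _ (at y p) (λ z t → sym (==→≡ (∧-elimˡ t))))
                             (cong (λ b → 𝟙 (b ∧ Q (at y p))) (T-true (==-refl (at y p))))) ⟩
      gcount (λ p → Q (at y p))
    ∎
    where
    open ≡-Reasoning
    off : ∀ v z → v ≢ z → ∀ b → (v == z) ∧ b ≡ false
    off v z ne b rewrite ≢→== ne = refl
    -- each neighbour z of y is the vertex of exactly one cell of y's grid
    spread : ∀ z → 𝟙 (adj y z ∧ Q z) ≡ gsum (λ p → 𝟙 ((at y p == z) ∧ Q z))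
    spread z with adj y z in e
    ... | true = sym (trans (gsum-single (cell y z (true-T e)) _
                               (λ p ne → cong 𝟙 (off (at y p) z (λ e' → ne (trans (sym (cell-at y p (at-adj y p)))
                                                                                     (cell-of e'))) (Q z))))
                            (cong (λ b → 𝟙 (b ∧ Q z)) (T-true (≡→== (at-cell y z (true-T e))))))
      where
      cell-of : ∀ {p} → at y p ≡ z → cell y (at y p) (at-adj y p) ≡ cell y z (true-T e)
      cell-of refl = cong (cell y _) (T-irrelevant _ _)
    ... | false = sym (gsum-zero (λ p → cong 𝟙 (off (at y p) z (λ e' → subst T e (subst (y ~_) e' (at-adj y p))) (Q z))))

module MuGraphs (G : Graph) (n : ℕ) (lg : LocallyGrid G n) where
  open Counting
  open Rook
  open CellCount
  open Distances G
  open LocalGrid G n lg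
  open CommonNeighbours G
  open Graph G using (N; adj)

  c₂-grid : ∀ x y → c₂ G x y ≡ gcount (λ p → adj y (at x p))
  c₂-grid x y = trans (c₂-count x y) (count-neighbours x (adj y))

  c₂-grid˘ : ∀ x y → c₂ G x y ≡ gcount (λ p → adj x (at y p))
  c₂-grid˘ x y = trans (c₂-count x y) (trans (count-ext (λ z → ∧-comm (adj x z) (adj y z))) (count-neighbours y (adj x)))

  -- Inside the grid of a common neighbour z of nonadjacent x ≠ y, the μ-graph looks like two corners.
  module ViaCommonNeighbour {x y : V G} (x≢y : x ≢ y) (x≁y : ¬ x ~ y) {z : V G} (zx : z ~ x) (zy : z ~ y) where
    P = cell z x zx
    Q = cell z y zy

    P≁Q : ¬ Rook P Q
    P≁Q r = x≁y (rook-cell→~ z zx zy r)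

    P≢Q : P ≢ Q
    P≢Q e = x≢y (cell-injective z zx zy e)

    independent : ∀ {w w'} → x ~ w → y ~ w → x ~ w' → y ~ w' → z ~ w → z ~ w' → w ≢ w' → ¬ w ~ w'
    independent xw yw xw' yw' zw zw' w≢w' ww' =
      common-neighbours-nonadjacent P≁Q P≢Q
        (~→rook-cell z zw zx (~-sym xw)) (~→rook-cell z zw zy (~-sym yw))
        (~→rook-cell z zw' zx (~-sym xw')) (~→rook-cell z zw' zy (~-sym yw'))
        (λ e → w≢w' (cell-injective z zw zw' e)) (~→rook-cell z zw zw' ww')

    -- and there are two of them: the vertices at the two corners of P and Q
    two-corners : Σ (V G) λ w₁ → Σ (V G) λ w₂ →
      x ~ w₁ × y ~ w₁ × x ~ w₂ × y ~ w₂ × z ~ w₁ × z ~ w₂ × w₁ ≢ w₂ × ¬ w₁ ~ w₂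
    two-corners with corners {P = P} {Q} P≁Q P≢Q
    ... | r₁P , r₁Q , r₂P , r₂Q , r₁≢r₂ =
        at z S₁ , at z S₂ ,
        ~-sym (subst (at z S₁ ~_) (at-cell z x zx) (rook→~ z r₁P)) ,
        ~-sym (subst (at z S₁ ~_) (at-cell z y zy) (rook→~ z r₁Q)) ,
        ~-sym (subst (at z S₂ ~_) (at-cell z x zx) (rook→~ z r₂P)) ,
        ~-sym (subst (at z S₂ ~_) (at-cell z y zy) (rook→~ z r₂Q)) ,
        at-adj z S₁ , at-adj z S₂ , (λ e → r₁≢r₂ (at-injective z e)) ,
        λ h → common-neighbours-nonadjacent P≁Q P≢Q r₁P r₁Q r₂P r₂Q r₁≢r₂ (~→rook z h)
      where
      S₁ = (proj₁ P , proj₂ Q)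
      S₂ = (proj₁ Q , proj₂ P)

  μ-shape : ∀ x y → x ≢ y → ¬ x ~ y → MuShape (λ p → adj y (at x p))
  μ-shape x y x≢y x≁y = cells-independent , two-neighbours
    where
    open ViaCommonNeighbour x≢y x≁y using (two-corners)
    cells-independent : ∀ r s s' → y ~ at x r → y ~ at x s → y ~ at x s' → Rook r s → Rook r s' → s ≢ s' → ¬ Rook s s'
    cells-independent r s s' yr ys ys' rs rs' s≢s' ss' =
      ViaCommonNeighbour.independent x≢y x≁y (~-sym (at-adj x r)) (~-sym yr)
        (at-adj x s) ys (at-adj x s') ys' (rook→~ x rs) (rook→~ x rs') (λ e → s≢s' (at-injective x e)) (rook→~ x ss')
    two-neighbours : ∀ r → y ~ at x r → Σ (Point n) λ s₁ → Σ (Point n) λ s₂ →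
      y ~ at x s₁ × y ~ at x s₂ × Rook r s₁ × Rook r s₂ × s₁ ≢ s₂ × ¬ Rook s₁ s₂
    two-neighbours r yr with two-corners {z = at x r} (~-sym (at-adj x r)) (~-sym yr)
    ... | w₁ , w₂ , xw₁ , yw₁ , xw₂ , yw₂ , rw₁ , rw₂ , w₁≢w₂ , w₁≁w₂ =
        cell x w₁ xw₁ , cell x w₂ xw₂ ,
        subst (y ~_) (sym (at-cell x w₁ xw₁)) yw₁ , subst (y ~_) (sym (at-cell x w₂ xw₂)) yw₂ ,
        subst (λ t → Rook t (cell x w₁ xw₁)) (cell-at x r (at-adj x r)) (~→rook-cell x (at-adj x r) xw₁ rw₁) ,
        subst (λ t → Rook t (cell x w₂ xw₂)) (cell-at x r (at-adj x r)) (~→rook-cell x (at-adj x r) xw₂ rw₂) ,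
        (λ e → w₁≢w₂ (cell-injective x xw₁ xw₂ e)) ,
        λ rr → w₁≁w₂ (rook-cell→~ x xw₁ xw₂ rr)

  c₂-even : ∀ x y → x ≢ y → ¬ x ~ y → ∃ λ q → c₂ G x y ≡ 2 * q
  c₂-even x y x≢y x≁y =
    let (q , e) = gcount-even _ (MuShape→RowPairs _ (μ-shape x y x≢y x≁y)) in q , trans (c₂-grid x y) e

  c₂≤2n : ∀ x y → x ≢ y → ¬ x ~ y → c₂ G x y ≤ 2 * n
  c₂≤2n x y x≢y x≁y = ≤-trans (≤-reflexive (c₂-grid x y)) (gcount≤2n _ (MuShape→RowPairs _ (μ-shape x y x≢y x≁y)))

module Diameter (G : Graph) (n : ℕ) (lg : LocallyGrid G n) (conn : Connected G)
                (μ-bound : MuGraphsAtLeast G (2 * (n ∸ 1))) where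
  open Booleans
  open Rook
  open CellCount
  open Distances G
  open LocalGrid G n lg
  open MuGraphs G n lg
  open Arithmetic using (2[k-1]≰2[k-2])
  open Graph G using (adj)

  -- If d(x,v) = 2, at most one neighbour of v lies at distance > 2 from x: two such neighbours
  -- would make the μ-graph of x and v avoid two crosses of v's grid, giving c₂(x,v) ≤ 2(n-2).
  unique-far-neighbour : ∀ x v → Dist G x v 2 → ∀ u u' → v ~ u → v ~ u' →
                         ¬ DistLe G x u 2 → ¬ DistLe G x u' 2 → u ≡ u'
  unique-far-neighbour x v d u u' vu vu' far far' with cell v u vu ≟ₚ cell v u' vu'
  ... | yes e = cell-injective v vu vu' e
  ... | no r≢r' = ⊥-elim (2[k-1]≰2[k-2] n (two-cells⇒2≤n _ _ r≢r') (≤-trans (μ-bound x v d) small-μ))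
    where
    x≢v = proj₁ (dist2-elim d)
    x≁v = proj₁ (proj₂ (dist2-elim d))
    avoids : ∀ t (vt : v ~ t) → ¬ DistLe G x t 2 → AvoidsCross (λ p → adj x (at v p)) (cell v t vt)
    avoids t vt far p (inj₁ refl) h = far (dist-mono (s≤s z≤n) (dist-1 (subst (x ~_) (at-cell v t vt) h)))
    avoids t vt far p (inj₂ r) h = far (dist-2 h (subst (at v p ~_) (at-cell v t vt) (rook→~ v r)))
    small-μ : c₂ G x v ≤ 2 * (n ∸ 2)
    small-μ = ≤-trans (≤-reflexive (c₂-grid˘ x v))
                      (two-crosses-bound _ (μ-shape v x (λ e → x≢v (sym e)) (λ h → x≁v (~-sym h)))
                                         _ _ r≢r' (avoids u vu far) (avoids u' vu' far'))

  -- If d(x,y) > 2 but y has a neighbour b with d(x,b) ≤ 2, then all neighbours of y are within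
  -- distance 2 of x: in y's grid, "within distance 2 of x" is closed under adjacency.
  far-vertex-neighbours : ∀ x y → ¬ DistLe G x y 2 → ∀ b → DistLe G x b 2 → b ~ y → ∀ w → y ~ w → DistLe G x w 2
  far-vertex-neighbours x y far b db by w yw =
    subst (λ t → DistLe G x t 2) (at-cell y w yw)
          (rook-connected Near closed (cell y b (~-sym by)) (cell y w yw)
                          (subst (λ t → DistLe G x t 2) (sym (at-cell y b (~-sym by))) db))
    where
    Near : Point n → Set
    Near p = DistLe G x (at y p) 2
    closed : ∀ p q → Near p → Rook p q → Near q
    closed p q near-p pq with dist≤2? x (at y q)
    ... | yes d = d
    ... | no far-q with dist-2-elim near-p
    ...   | inj₁ refl = ⊥-elim (far (dist-mono (s≤s z≤n) (dist-1 (~-sym (at-adj y p)))))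
    ...   | inj₂ (inj₁ xv) = ⊥-elim (far-q (dist-2 xv (rook→~ y pq)))
    ...   | inj₂ (inj₂ (z , xz , zv)) with adj x (at y p) in e
    ...     | true = ⊥-elim (far-q (dist-2 (true-T e) (rook→~ y pq)))
    ...     | false = ⊥-elim (~-≢ (at-adj y q) (unique-far-neighbour x (at y p) d₂ y (at y q)
                                                   (~-sym (at-adj y p)) (rook→~ y pq) far far-q))
      where
      d₂ : Dist G x (at y p) 2
      d₂ = dist2-intro (λ e' → far (dist-mono (s≤s z≤n) (dist-1 (subst (_~ y) (sym e') (~-sym (at-adj y p))))))
                       (λ h → subst T e h) xz zv

  diameter≤3 : DiamLe G 3
  diameter≤3 x y = reach (proj₂ (conn x y)) (dist-mono z≤n dist-refl)
    where
    step : ∀ {u u'} → DistLe G x u 3 → u ~ u' → DistLe G x u' 3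
    step {u} d h with dist≤2? x u
    ... | yes d₂ = dist-snoc d₂ h
    ... | no far = let (b , db , bu) = dist-3-elim d far in
                   dist-mono (s≤s (s≤s z≤n)) (far-vertex-neighbours x u far b db bu _ h)
    reach : ∀ {u k} → Walk G u y k → DistLe G x u 3 → DistLe G x y 3
    reach nil d = d
    reach (cons h w) d = reach w (step d h)

-- Maximal cliques: seen from any of its vertices c, a maximal clique C is c together with a line
-- of c's grid.
module MaximalCliques (G : Graph) (n : ℕ) (lg : LocallyGrid G n) (C : Subset (Graph.N G)) (mc : IsMaximalClique G C) where
  open Booleans
  open Membership
  open Counting
  open Rook
  open CellCount
  open Distances G
  open LocalGrid G n lg
  open Graph G using (N; adj)

  inC : V G → Bool
  inC z = lookup C z

  clique-adj : ∀ y z → T (inC y) → T (inC z) → y ≢ z → y ~ z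
  clique-adj y z ty tz ne = proj₁ mc y z (T→∈ ty) (T→∈ tz) ne

  maximal : ∀ (D : Subset N) → IsClique G D → (∀ {z} → T (inC z) → z ∈ D) → ∀ {z} → z ∈ D → T (inC z)
  maximal D D-clique C⊆D h = ∈→T (proj₂ mc D D-clique (λ h' → C⊆D (∈→T h')) h)

  nonempty : V G → ∃ λ c → T (inC c)
  nonempty v with search inC
  ... | inj₁ found = found
  ... | inj₂ none = ⊥-elim (none v (maximal D D-clique (λ {z} t → ⊥-elim (none z t)) (∈-tabulate⁺ _ v (==-refl v))))
    where
    D = tabulate (_== v)
    D-clique : IsClique G D
    D-clique y z hy hz ne = ⊥-elim (ne (trans (==→≡ (∈-tabulate⁻ _ y hy)) (sym (==→≡ (∈-tabulate⁻ _ z hz)))))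

  -- If the grid has a cell, C is not a single vertex: otherwise C plus a neighbour would be a larger clique.
  second-vertex : ∀ c → T (inC c) → Point n → ∃ λ c' → T (inC c') × c' ≢ c
  second-vertex c hc p with search (λ z → inC z ∧ not (z == c))
  ... | inj₁ (z , t) = z , ∧-elimˡ t , λ e → not-elim (∧-elimʳ {inC z} t) (≡→== e)
  ... | inj₂ none = ⊥-elim (none u (∧-intro u∈C (not-intro (λ e → ~-≢ (at-adj c p) (sym (==→≡ e))))))
    where
    u = at c p
    D = tabulate (λ z → (z == c) ∨ (z == u))
    only-c : ∀ z → T (inC z) → z ≡ c
    only-c z t with z ≟ c
    ... | yes e = e
    ... | no z≢c = ⊥-elim (none z (∧-intro t (not-intro (λ e → z≢c (==→≡ e)))))
    D-members : ∀ z → z ∈ D → z ≡ c ⊎ z ≡ u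
    D-members z h with ∨-elim {z == c} (∈-tabulate⁻ _ z h)
    ... | inj₁ t = inj₁ (==→≡ t)
    ... | inj₂ t = inj₂ (==→≡ t)
    D-clique : IsClique G D
    D-clique y z hy hz ne with D-members y hy | D-members z hz
    ... | inj₁ refl | inj₁ refl = ⊥-elim (ne refl)
    ... | inj₁ refl | inj₂ refl = at-adj c p
    ... | inj₂ refl | inj₁ refl = ~-sym (at-adj c p)
    ... | inj₂ refl | inj₂ refl = ⊥-elim (ne refl)
    u∈C : T (inC u)
    u∈C = maximal D D-clique (λ {z} t → ∈-tabulate⁺ _ z (∨-introˡ (≡→== (only-c z t)))) (∈-tabulate⁺ _ u (∨-introʳ {u == c} (==-refl u)))

  record LineOf (c : V G) : Set where
    field
      line : Line n
      on-line : ∀ p → T (inC (at c p)) → OnLine line p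
      in-C : ∀ p → OnLine line p → T (inC (at c p))

  opaque
    line-of : ∀ c → T (inC c) → Point n → LineOf c
    line-of c hc p with second-vertex c hc p
    ... | c' , hc' , c'≢c with clique-within-line Q (cell c c' cc') Qc' Q-clique
      where
      cc' : c ~ c'
      cc' = clique-adj c c' hc hc' (λ e → c'≢c (sym e))
      Q : Point n → Bool
      Q p = inC (at c p)
      Qc' : T (Q (cell c c' cc'))
      Qc' = subst (λ t → T (inC t)) (sym (at-cell c c' cc')) hc'
      Q-clique : ∀ p q → T (Q p) → T (Q q) → p ≢ q → Rook p q
      Q-clique p q tp tq ne = ~→rook c (clique-adj (at c p) (at c q) tp tq (λ e → ne (at-injective c e)))
    ... | ℓ , _ , on-ℓ = record { line = ℓ ; on-line = on-ℓ ; in-C = in-C }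
      where
      -- c together with the line ℓ is a clique containing C, hence equal to C
      D : Subset N
      D = tabulate (λ z → (z == c) ∨ any-cell? (λ p → onLine ℓ p ∧ (at c p == z)))
      D-members : ∀ z → z ∈ D → z ≡ c ⊎ ∃ λ p → OnLine ℓ p × at c p ≡ z
      D-members z h with ∨-elim {z == c} (∈-tabulate⁻ _ z h)
      ... | inj₁ t = inj₁ (==→≡ t)
      ... | inj₂ t = let (p , tp) = any-cell?-elim _ t in inj₂ (p , onLine→ ℓ (∧-elimˡ tp) , ==→≡ (∧-elimʳ {onLine ℓ p} tp))
      D-clique : IsClique G D
      D-clique y z hy hz ne with D-members y hy | D-members z hz
      ... | inj₁ refl | inj₁ refl = ⊥-elim (ne refl)
      ... | inj₁ refl | inj₂ (q , _ , refl) = at-adj c q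
      ... | inj₂ (p , _ , refl) | inj₁ refl = ~-sym (at-adj c p)
      ... | inj₂ (p , op , refl) | inj₂ (q , oq , refl) = rook→~ c (line-clique ℓ op oq (λ e → ne (cong (at c) e)))
      C⊆D : ∀ {z} → T (inC z) → z ∈ D
      C⊆D {z} t with z ≟ c
      ... | yes e = ∈-tabulate⁺ _ z (∨-introˡ (≡→== e))
      ... | no z≢c = ∈-tabulate⁺ _ z (∨-introʳ {z == c} (any-cell?-intro _ (cell c z cz)
                       (∧-intro (→onLine ℓ (on-ℓ _ (subst (λ t → T (inC t)) (sym (at-cell c z cz)) t))) (≡→== (at-cell c z cz)))))
        where
        cz : c ~ z
        cz = clique-adj c z hc t (λ e → z≢c (sym e))
      in-C : ∀ p → OnLine ℓ p → T (inC (at c p))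
      in-C p op = maximal D D-clique C⊆D (∈-tabulate⁺ _ (at c p) (∨-introʳ {at c p == c}
                    (any-cell?-intro _ p (∧-intro (→onLine ℓ op) (==-refl (at c p))))))

  size : ∀ c → T (inC c) → Point n → count inC ≡ suc n
  size c hc p = begin
      count inC
    ≡⟨ count-split (_== c) inC ⟩
      count (λ z → (z == c) ∧ inC z) + count (λ z → not (z == c) ∧ inC z)
    ≡⟨ cong₂ _+_ (count-single _ c (∧-intro (==-refl c) hc) (λ z t → ==→≡ (∧-elimˡ t)))
                 (count-ext⇔ {f = λ z → not (z == c) ∧ inC z} {g = λ z → adj c z ∧ inC z} others→nbrs nbrs→others) ⟩
      1 + count (λ z → adj c z ∧ inC z)
    ≡⟨ cong suc (count-neighbours c inC) ⟩
      1 + gcount (λ p → inC (at c p))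
    ≡⟨ cong suc (gcount-ext⇔ (λ p t → →onLine line (on-line p t)) (λ p t → in-C p (onLine→ line t))) ⟩
      1 + gcount (onLine line)
    ≡⟨ cong suc (gcount-line line) ⟩
      suc n
    ∎
    where
    open ≡-Reasoning
    open LineOf (line-of c hc p)
    others→nbrs : ∀ z → T (not (z == c) ∧ inC z) → T (adj c z ∧ inC z)
    others→nbrs z t = ∧-intro (clique-adj c z hc (∧-elimʳ {not (z == c)} t) (λ e → not-elim (∧-elimˡ t) (≡→== (sym e))))
                              (∧-elimʳ {not (z == c)} t)
    nbrs→others : ∀ z → T (adj c z ∧ inC z) → T (not (z == c) ∧ inC z)
    nbrs→others z t = ∧-intro (not-intro (λ e → ~-≢ (∧-elimˡ t) (sym (==→≡ e)))) (∧-elimʳ {adj c z} t)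

  record SecondNeighbour (u c : V G) : Set where
    field
      other : V G
      other∈C : T (inC other)
      other≢c : other ≢ c
      other~u : other ~ u
      only : ∀ z → T (inC z) → z ~ u → z ≡ c ⊎ z ≡ other

  second-neighbour : ∀ u c → ¬ T (inC u) → T (inC c) → c ~ u → SecondNeighbour u c
  second-neighbour u c u∉C hc cu = from-projection (line-projection line (cell c u cu) off-line)
    where
    -- u's cell is off the line of C in c's grid; its projection onto the line is the other neighbour
    open LineOf (line-of c hc (cell c u cu))
    off-line : ¬ OnLine line (cell c u cu)
    off-line o = u∉C (subst (λ t → T (inC t)) (at-cell c u cu) (in-C _ o))
    from-projection : Σ (Point n) (λ s → OnLine line s × Rook s (cell c u cu) ×
                        (∀ s' → OnLine line s' → Rook s' (cell c u cu) → s' ≡ s)) → SecondNeighbour u c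
    from-projection (s , on-s , s~u , unique) = record
      { other = at c s ; other∈C = in-C s on-s ; other≢c = λ e → ~-≢ (at-adj c s) (sym e)
      ; other~u = subst (at c s ~_) (at-cell c u cu) (rook→~ c s~u) ; only = only }
      where
      only : ∀ z → T (inC z) → z ~ u → z ≡ c ⊎ z ≡ at c s
      only z tz zu with z ≟ c
      ... | yes e = inj₁ e
      ... | no z≢c = inj₂ (trans (sym (at-cell c z cz)) (cong (at c) (unique (cell c z cz)
                       (on-line _ (subst (λ t → T (inC t)) (sym (at-cell c z cz)) tz)) (~→rook-cell c cz cu zu))))
        where
        cz : c ~ z
        cz = clique-adj c z hc tz (λ e → z≢c (sym e))

  two-neighbours-suffice : ∀ w c c' → ¬ T (inC w) → T (inC c) → T (inC c') → c' ≢ c → c ~ w → c' ~ w →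
                           ∀ z → T (inC z) → z ~ w → z ≡ c ⊎ z ≡ c'
  two-neighbours-suffice w c c' w∉C hc hc' c'≢c cw c'w z tz zw =
    [ inj₁ , (λ e → inj₂ (trans e (sym c'≡other))) ]′ (only z tz zw)
    where
    open SecondNeighbour (second-neighbour w c w∉C hc cw)
    c'≡other : c' ≡ other
    c'≡other = [ (λ e → ⊥-elim (c'≢c e)) , (λ e → e) ]′ (only c' hc' c'w)

  C-degree : V G → ℕ
  C-degree u = count (λ z → inC z ∧ adj z u)

  C-degree-two : ∀ u c → ¬ T (inC u) → T (inC c) → c ~ u → C-degree u ≡ 2
  C-degree-two u c u∉C hc cu = trans (count-split (_== c) (λ z → inC z ∧ adj z u))
    (cong₂ _+_ (count-single _ c (∧-intro (==-refl c) (∧-intro hc cu)) (λ z t → ==→≡ (∧-elimˡ t)))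
               (count-single _ other (∧-intro (not-intro (λ e → other≢c (==→≡ e))) (∧-intro other∈C other~u)) is-other))
    where
    open SecondNeighbour (second-neighbour u c u∉C hc cu)
    is-other : ∀ z → T (not (z == c) ∧ (inC z ∧ adj z u)) → z ≡ other
    is-other z t with only z (∧-elimˡ (∧-elimʳ {not (z == c)} t)) (∧-elimʳ {inC z} (∧-elimʳ {not (z == c)} t))
    ... | inj₁ e = ⊥-elim (not-elim (∧-elimˡ t) (≡→== e))
    ... | inj₂ e = e

  C-degree-outside : ∀ u → ¬ T (inC u) → C-degree u ≡ 2 * 𝟙 (any? (λ z → inC z ∧ adj z u))
  C-degree-outside u u∉C with any? (λ z → inC z ∧ adj z u) in e
  ... | true = let (c , t) = any?-elim _ (true-T e) in C-degree-two u c u∉C (∧-elimˡ t) (∧-elimʳ {inC c} t)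
  ... | false = count-none (λ z → inC z ∧ adj z u) (λ z t → subst T e (any?-intro (λ z → inC z ∧ adj z u) z t))

module OutsideVertex (G : Graph) (n : ℕ) (lg : LocallyGrid G n) (conn : Connected G)
                     (μ-bound : MuGraphsAtLeast G (2 * (n ∸ 1)))
                     (C : Subset (Graph.N G)) (mc : IsMaximalClique G C) (x : V G) (x∉C : x ∉ C) where
  open Booleans
  open Membership
  open Counting
  open Rook
  open CellCount
  open Distances G
  open CommonNeighbours G
  open LocalGrid G n lg
  open MuGraphs G n lg
  open Diameter G n lg conn μ-bound
  open MaximalCliques G n lg C mc
  open Arithmetic
  open Graph G using (N; adj)

  x-out : ¬ T (inC x)
  x-out t = x∉C (T→∈ t)

  -- The grid is nonempty: the first step of a walk from x into C is a neighbour of x.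
  some-cell : Point n
  some-cell = first-step (proj₂ (conn x c)) x≢c
    where
    c = proj₁ (nonempty x)
    x≢c : x ≢ c
    x≢c e = x-out (subst (λ t → T (inC t)) (sym e) (proj₂ (nonempty x)))
    first-step : ∀ {y k} → Walk G x y k → x ≢ y → Point n
    first-step nil ne = ⊥-elim (ne refl)
    first-step (cons h _) _ = cell x _ h

  not-within-0 : ¬ SetDistLe G x C 0
  not-within-0 (z , z∈C , d) = x∉C (subst (_∈ C) (sym (dist-0-elim d)) z∈C)

  -- d(x,C) ∈ {1, 2}: if x has no neighbour in C and c ∈ C is at distance 3, then by
  -- far-vertex-neighbours any other vertex of C is at distance ≤ 2.
  set-dist-1-or-2 : SetDist G x C 1 ⊎ SetDist G x C 2
  set-dist-1-or-2 with search (λ z → inC z ∧ adj x z)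
  ... | inj₁ (a , t) = inj₁ ((a , T→∈ (∧-elimˡ t) , dist-1 (∧-elimʳ {inC a} t)) ,
                             λ { zero _ → not-within-0 ; (suc m) (s≤s ()) })
  ... | inj₂ none = inj₂ (within-2 (dist≤2? x c) ,
                          λ { zero _ → not-within-0 ; (suc zero) _ → not-within-1 ; (suc (suc m)) (s≤s (s≤s ())) })
    where
    c = proj₁ (nonempty x)
    hc = proj₂ (nonempty x)
    not-within-1 : ¬ SetDistLe G x C 1
    not-within-1 (z , z∈C , d) = [ (λ e → x∉C (subst (_∈ C) (sym e) z∈C)) , (λ h → none z (∧-intro (∈→T z∈C) h)) ]′ (dist-1-elim d)
    within-2 : Dec (DistLe G x c 2) → SetDistLe G x C 2
    within-2 (yes d) = c , T→∈ hc , d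
    within-2 (no far) with dist-3-elim (diameter≤3 x c) far | second-vertex c hc some-cell
    ... | b , db , bc | c' , hc' , c'≢c =
          c' , T→∈ hc' , far-vertex-neighbours x c far b db bc c' (clique-adj c c' hc hc' (λ e → c'≢c (sym e)))

  touches-C : V G → Bool
  touches-C u = any? (λ z → inC z ∧ adj z u)

  shares-C-neighbour : V G → Bool
  shares-C-neighbour u = any? (λ z → inC z ∧ (adj z u ∧ adj x z))

  no-shared→ : ∀ {u} → T (not (shares-C-neighbour u)) → ∀ z → T (inC z) → z ~ u → ¬ x ~ z
  no-shared→ {u} t z tz zu xz = not-elim t (any?-intro _ z (∧-intro tz (∧-intro zu xz)))

  →no-shared : ∀ {u} → (∀ z → T (inC z) → z ~ u → ¬ x ~ z) → T (not (shares-C-neighbour u))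
  →no-shared {u} h = not-intro (λ t → let (z , tz) = any?-elim _ t in
    h z (∧-elimˡ tz) (∧-elimˡ (∧-elimʳ {inC z} tz)) (∧-elimʳ {adj z u} (∧-elimʳ {inC z} tz)))

  screened : V G → Bool
  screened u = adj x u ∧ (not (inC u) ∧ (touches-C u ∧ not (shares-C-neighbour u)))

  record Screened (u : V G) : Set where
    field
      x~u : x ~ u
      u∉C : ¬ T (inC u)
      c c' : V G
      c∈C : T (inC c)
      c'∈C : T (inC c')
      c'≢c : c' ≢ c
      c~u : c ~ u
      c'~u : c' ~ u
      only : ∀ z → T (inC z) → z ~ u → z ≡ c ⊎ z ≡ c'
      x≁c : ¬ x ~ c
      x≁c' : ¬ x ~ c'

  screened-structure : ∀ {u} → T (screened u) → Screened u
  screened-structure {u} t = record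
    { x~u = ∧-elimˡ t ; u∉C = u∉C ; c = c ; c' = other ; c∈C = c∈C ; c'∈C = other∈C ; c'≢c = other≢c
    ; c~u = c~u ; c'~u = other~u ; only = only ; x≁c = no-shared→ free c c∈C c~u ; x≁c' = no-shared→ free other other∈C other~u }
    where
    t₁ = ∧-elimʳ {adj x u} t
    u∉C = not-elim (∧-elimˡ t₁)
    t₂ = ∧-elimʳ {not (inC u)} t₁
    free = ∧-elimʳ {touches-C u} t₂
    touching = any?-elim _ (∧-elimˡ t₂)
    c = proj₁ touching
    c∈C = ∧-elimˡ (proj₂ touching)
    c~u = ∧-elimʳ {inC c} (proj₂ touching)
    open SecondNeighbour (second-neighbour u c u∉C c∈C c~u)

  twin? : V G → V G → Bool
  twin? u w = screened u ∧ (adj u w ∧ (adj x w ∧ not (any? (λ z → inC z ∧ (adj z u ∧ not (adj z w))))))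

  twin-intro : ∀ {u w} → T (screened u) → u ~ w → x ~ w → (∀ z → T (inC z) → z ~ u → z ~ w) → T (twin? u w)
  twin-intro {u} {w} su uw xw covers = ∧-intro su (∧-intro uw (∧-intro xw (not-intro (λ t →
    let (z , tz) = any?-elim _ t in
    not-elim (∧-elimʳ {adj z u} (∧-elimʳ {inC z} tz)) (covers z (∧-elimˡ tz) (∧-elimˡ (∧-elimʳ {inC z} tz)))))))

  twin-elim : ∀ {u w} → T (twin? u w) → T (screened u) × u ~ w × x ~ w × (∀ z → T (inC z) → z ~ u → z ~ w)
  twin-elim {u} {w} t = ∧-elimˡ t , ∧-elimˡ t₁ , ∧-elimˡ t₂ , covers
    where
    t₁ = ∧-elimʳ {screened u} t
    t₂ = ∧-elimʳ {adj u w} t₁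
    covers : ∀ z → T (inC z) → z ~ u → z ~ w
    covers z tz zu = not-not (λ zw → not-elim (∧-elimʳ {adj x w} t₂) (any?-intro _ z (∧-intro tz (∧-intro zu zw))))

  twin-sym : ∀ {u w} → T (twin? u w) → T (twin? w u)
  twin-sym {u} {w} t = twin-intro screened-w (~-sym uw) x~u covered
    where
    open Screened (screened-structure (proj₁ (twin-elim t)))
    uw = proj₁ (proj₂ (twin-elim t))
    xw = proj₁ (proj₂ (proj₂ (twin-elim t)))
    covers = proj₂ (proj₂ (proj₂ (twin-elim t)))
    w∉C : ¬ T (inC w)
    w∉C tw = [ (λ e → x≁c (subst (x ~_) e xw)) , (λ e → x≁c' (subst (x ~_) e xw)) ]′ (only w tw (~-sym uw))
    only-w : ∀ z → T (inC z) → z ~ w → z ≡ c ⊎ z ≡ c'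
    only-w = two-neighbours-suffice w c c' w∉C c∈C c'∈C c'≢c (covers c c∈C c~u) (covers c' c'∈C c'~u)
    x≁only : ∀ {z} → z ≡ c ⊎ z ≡ c' → ¬ x ~ z
    x≁only (inj₁ refl) = x≁c
    x≁only (inj₂ refl) = x≁c'
    screened-w : T (screened w)
    screened-w = ∧-intro xw (∧-intro (not-intro w∉C) (∧-intro (any?-intro _ c (∧-intro c∈C (covers c c∈C c~u)))
                   (→no-shared (λ z tz zw → x≁only (only-w z tz zw)))))
    covered : ∀ z → T (inC z) → z ~ w → z ~ u
    covered z tz zw = [ (λ e → subst (_~ u) (sym e) c~u) , (λ e → subst (_~ u) (sym e) c'~u) ]′ (only-w z tz zw)

  twin-irrefl : ∀ u → twin? u u ≡ false
  twin-irrefl u = ¬T-false (λ t → ~-irrefl (proj₁ (proj₂ (twin-elim t))))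

  -- Every screened u has exactly one twin: in u's grid, the edge {c, c'} and the cell of x
  -- (adjacent to neither) have a unique common neighbour.
  unique-twin : ∀ u → T (screened u) → Σ (V G) λ w → T (twin? u w) × (∀ w' → T (twin? u w') → w' ≡ w)
  unique-twin u su = at u R , twin-intro su (at-adj u R) x~R covers , unique
    where
    open Screened (screened-structure su)
    u~x = ~-sym x~u
    u~c = ~-sym c~u
    u~c' = ~-sym c'~u
    x≢c : ∀ {z} → T (inC z) → x ≢ z
    x≢c tz e = x-out (subst (λ t → T (inC t)) (sym e) tz)
    meeting = edge-point-common-neighbour {A = cell u c u~c} {cell u c' u~c'} {cell u x u~x}
               (~→rook-cell u u~c u~c' (clique-adj c c' c∈C c'∈C (λ e → c'≢c (sym e))))
               (λ r → x≁c (rook-cell→~ u u~x u~c r)) (λ r → x≁c' (rook-cell→~ u u~x u~c' r))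
               (λ e → x≢c c∈C (cell-injective u u~x u~c e)) (λ e → x≢c c'∈C (cell-injective u u~x u~c' e))
    R = proj₁ meeting
    R~x = proj₁ (proj₂ meeting)
    R~c = proj₁ (proj₂ (proj₂ meeting))
    R~c' = proj₁ (proj₂ (proj₂ (proj₂ meeting)))
    R-unique = proj₂ (proj₂ (proj₂ (proj₂ meeting)))
    at-R~ : ∀ {v} (uv : u ~ v) → Rook R (cell u v uv) → v ~ at u R
    at-R~ {v} uv r = ~-sym (subst (at u R ~_) (at-cell u v uv) (rook→~ u r))
    x~R : x ~ at u R
    x~R = at-R~ u~x R~x
    covers : ∀ z → T (inC z) → z ~ u → z ~ at u R
    covers z tz zu = [ (λ e → subst (_~ at u R) (sym e) (at-R~ u~c R~c)) , (λ e → subst (_~ at u R) (sym e) (at-R~ u~c' R~c')) ]′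
                       (only z tz zu)
    unique : ∀ w' → T (twin? u w') → w' ≡ at u R
    unique w' t = let (_ , uw' , xw' , covers') = twin-elim t in
      trans (sym (at-cell u w' uw')) (cong (at u) (R-unique (cell u w' uw')
        (~→rook-cell u uw' u~x (~-sym xw')) (~→rook-cell u uw' u~c (~-sym (covers' c c∈C c~u)))
        (~→rook-cell u uw' u~c' (~-sym (covers' c' c'∈C c'~u)))))

  screened-even : 2 ∣ count screened
  screened-even = subst (2 ∣_) (sum-cong-≗ twins-of) (pairs-even twin? (λ u w → T-ext twin-sym twin-sym) twin-irrefl)
    where
    twins-of : ∀ u → count (twin? u) ≡ 𝟙 (screened u)
    twins-of u = by-cases (screened u) refl
      where
      by-cases : ∀ b → screened u ≡ b → count (twin? u) ≡ 𝟙 b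
      by-cases true e = let (w , t , unique) = unique-twin u (true-T e) in count-single (twin? u) w t unique
      by-cases false e = count-none (twin? u) (λ w t → subst T e (proj₁ (twin-elim t)))

  neighbour-in-C : SetDist G x C 1 → ∃ λ a → T (inC a) × x ~ a
  neighbour-in-C ((z , z∈C , d) , _) =
    [ (λ e → ⊥-elim (x∉C (subst (_∈ C) (sym e) z∈C))) , (λ h → z , ∈→T z∈C , h) ]′ (dist-1-elim d)

  1≤n : 1 ≤ n
  1≤n = inhabited (proj₁ some-cell)
    where
    inhabited : ∀ {k} → Fin k → 1 ≤ k
    inhabited {suc k} _ = s≤s z≤n

  module FarFromClique (far : SetDist G x C 2) where

    x≁C : ∀ z → T (inC z) → ¬ x ~ z
    x≁C z tz h = proj₂ far 1 (s≤s (s≤s z≤n)) (z , T→∈ tz , dist-1 h)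

    -- Every μ-graph of x with a vertex y of C is minimal: in y's grid, the μ-graph misses the line of C.
    μ-minimal : ∀ y → y ∈ C → Dist G x y 2 → c₂ G x y ≡ 2 * (n ∸ 1)
    μ-minimal y y∈C d = ≤-antisym upper (μ-bound x y d)
      where
      open LineOf (line-of y (∈→T y∈C) some-cell)
      x≢y = proj₁ (dist2-elim d)
      x≁y = proj₁ (proj₂ (dist2-elim d))
      upper : c₂ G x y ≤ 2 * (n ∸ 1)
      upper = ≤-trans (≤-reflexive (c₂-grid˘ x y))
                      (empty-line-bound _ (μ-shape y x (λ e → x≢y (sym e)) (λ h → x≁y (~-sym h))) line
                                        (λ p on h → x≁C (at y p) (in-C p on) h))

    -- Each neighbour of x lies outside C, and it is adjacent to C exactly when it is screened.
    neighbour-degree : ∀ u → 𝟙 (adj x u) * C-degree u ≡ 2 * 𝟙 (screened u)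
    neighbour-degree u = by-cases (adj x u) refl
      where
      by-cases : ∀ b → adj x u ≡ b → 𝟙 b * C-degree u ≡ 2 * 𝟙 (screened u)
      by-cases true e = trans (+-identityʳ _) (trans (C-degree-outside u u∉C) (cong (λ b → 2 * 𝟙 b) (T-ext touching→screened touching)))
        where
        u∉C : ¬ T (inC u)
        u∉C tu = x≁C u tu (true-T e)
        touching→screened : T (touches-C u) → T (screened u)
        touching→screened t = ∧-intro (true-T e) (∧-intro (not-intro u∉C) (∧-intro t (→no-shared (λ z tz _ → x≁C z tz))))
        touching : T (screened u) → T (touches-C u)
        touching t = ∧-elimˡ (∧-elimʳ {not (inC u)} (∧-elimʳ {adj x u} t))
      by-cases false e = cong (λ b → 2 * 𝟙 b) (sym (¬T-false (λ t → subst T e (∧-elimˡ t))))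

    sum-c₂-over-C : sum (λ z → 𝟙 (inC z) * c₂ G x z) ≡ 2 * count screened
    sum-c₂-over-C = trans (double-count x inC) (trans (sum-cong-≗ neighbour-degree) (sym (*-distribˡ-sum 2 (λ u → 𝟙 (screened u)))))

    -- For even n, not all of C is at distance 2: otherwise 2(n-1)(n+1) = 2 · #screened with
    -- #screened even, while (n-1)(n+1) is odd.
    not-all-at-distance-2 : 2 ∣ n → ∃ λ z → z ∈ C × ¬ Dist G x z 2
    not-all-at-distance-2 2∣n with search (λ z → inC z ∧ not (dist2? x z))
    ... | inj₁ (z , t) = z , T→∈ (∧-elimˡ t) , λ d → not-elim (∧-elimʳ {inC z} t) (dist2→dist2? d)
    ... | inj₂ none = ⊥-elim (even-n⇒odd n (count screened) 1≤n 2∣n total screened-even)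
      where
      K = 2 * (n ∸ 1)
      at-distance-2 : ∀ z → T (inC z) → Dist G x z 2
      at-distance-2 z tz = dist2?→dist2 (not-not (λ t → none z (∧-intro tz t)))
      pointwise : ∀ z → 𝟙 (inC z) * c₂ G x z ≡ K * 𝟙 (inC z)
      pointwise z = by-cases (inC z) refl
        where
        by-cases : ∀ b → inC z ≡ b → 𝟙 b * c₂ G x z ≡ K * 𝟙 b
        by-cases true e = trans (+-identityʳ _) (trans (μ-minimal z (T→∈ (true-T e)) (at-distance-2 z (true-T e))) (sym (*-identityʳ K)))
        by-cases false e = sym (*-zeroʳ K)
      c = proj₁ (nonempty x)
      total : K * suc n ≡ 2 * count screened
      total = begin
          K * suc n
        ≡⟨ cong (K *_) (sym (size c (proj₂ (nonempty x)) some-cell)) ⟩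
          K * count inC
        ≡⟨ *-distribˡ-sum K (λ z → 𝟙 (inC z)) ⟩
          sum (λ z → K * 𝟙 (inC z))
        ≡⟨ sum-cong-≗ (λ z → sym (pointwise z)) ⟩
          sum (λ z → 𝟙 (inC z) * c₂ G x z)
        ≡⟨ sum-c₂-over-C ⟩
          2 * count screened
        ∎
        where open ≡-Reasoning

  module NearClique (a : V G) (a∈C : T (inC a)) (x~a : x ~ a) where
    open SecondNeighbour (second-neighbour x a x-out a∈C (~-sym x~a))
      renaming (other to b; other∈C to b∈C; other≢c to b≢a; other~u to b~x; only to only-neighbours)

    x~b : x ~ b
    x~b = ~-sym b~x

    a~b : a ~ b
    a~b = clique-adj a b a∈C b∈C (λ e → b≢a (sym e))

    only-a-b : ∀ z → T (inC z) → x ~ z → z ≡ a ⊎ z ≡ b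
    only-a-b z tz xz = only-neighbours z tz (~-sym xz)

    -- The rest D = C ∖ {a, b} of the clique.
    inD : V G → Bool
    inD z = inC z ∧ not (adj x z)

    D⊆Γ : ∀ {v} → T (inC v) → x ~ v → ∀ z → T (inD z) → v ~ z
    D⊆Γ {v} tv xv z t = clique-adj v z tv (∧-elimˡ t) (λ e → not-elim (∧-elimʳ {inC z} t) (subst (x ~_) e xv))

    D-at-distance-2 : ∀ z → T (inD z) → Dist G x z 2
    D-at-distance-2 z t = dist2-intro (λ e → x-out (subst (λ t' → T (inC t')) (sym e) (∧-elimˡ t)))
                                      (not-elim (∧-elimʳ {inC z} t)) x~a (D⊆Γ a∈C x~a z t)

    -- μ-graphs from x to D have order 2(n-1) or 2n: even, between the lower bound and 2n.
    c₂-values : ∀ z → T (inD z) → c₂ G x z ≡ 2 * (n ∸ 1) ⊎ c₂ G x z ≡ 2 * n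
    c₂-values z t = [ (λ e' → inj₁ (trans e e')) , (λ e' → inj₂ (trans e e')) ]′
                      (two-values n q (subst (2 * (n ∸ 1) ≤_) e (μ-bound x z d)) (subst (_≤ 2 * n) e (c₂≤2n x z x≢z x≁z)))
      where
      d = D-at-distance-2 z t
      x≢z = proj₁ (dist2-elim d)
      x≁z = proj₁ (proj₂ (dist2-elim d))
      q = proj₁ (c₂-even x z x≢z x≁z)
      e = proj₂ (c₂-even x z x≢z x≁z)

    2≤n : 2 ≤ n
    2≤n = two-cells⇒2≤n (cell x a x~a) (cell x b x~b) (λ e → b≢a (sym (cell-injective x x~a x~b e)))

    size-D : count inD ≡ n ∸ 1
    size-D = cong (_∸ 2) (sym split)
      where
      neighbours-in-C : count (λ z → adj x z ∧ inC z) ≡ 2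
      neighbours-in-C = trans (count-ext (λ z → trans (∧-comm (adj x z) (inC z)) (cong (inC z ∧_) (Graph.sym G x z))))
                              (C-degree-two x a x-out a∈C (~-sym x~a))
      split : suc n ≡ 2 + count inD
      split = trans (sym (size a a∈C some-cell))
                    (trans (count-split (adj x) inC) (cong₂ _+_ neighbours-in-C (count-ext (λ z → ∧-comm (not (adj x z)) (inC z)))))

    K = 2 * (n ∸ 1)

    -- The vertices of D whose μ-graph with x is minimal; the claim is that they are evenly many.
    minimal : V G → Bool
    minimal z = inD z ∧ (c₂ G x z ≡ᵇ K)

    S = sum (λ z → 𝟙 (inD z) * c₂ G x z)

    -- First count: each z ∈ D contributes c₂(x,z) + 2[minimal] = 2n.
    first-count : S + 2 * count minimal ≡ 2 * n * count inD
    first-count = trans (cong (S +_) (*-distribˡ-sum 2 (λ z → 𝟙 (minimal z))))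
                  (trans (sym (∑-distrib-+ (λ z → 𝟙 (inD z) * c₂ G x z) (λ z → 2 * 𝟙 (minimal z))))
                  (trans (sum-cong-≗ pointwise) (sym (*-distribˡ-sum (2 * n) (λ z → 𝟙 (inD z))))))
      where
      pointwise : ∀ z → 𝟙 (inD z) * c₂ G x z + 2 * 𝟙 (minimal z) ≡ 2 * n * 𝟙 (inD z)
      pointwise z = by-cases (inD z) refl
        where
        by-cases : ∀ b → inD z ≡ b → 𝟙 b * c₂ G x z + 2 * 𝟙 (b ∧ (c₂ G x z ≡ᵇ K)) ≡ 2 * n * 𝟙 b
        by-cases false _ = sym (*-zeroʳ (2 * n))
        by-cases true e = [ when-minimal , when-maximal ]′ (c₂-values z (true-T e))
          where
          when-minimal : c₂ G x z ≡ K → 1 * c₂ G x z + 2 * 𝟙 (c₂ G x z ≡ᵇ K) ≡ 2 * n * 1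
          when-minimal c = trans (cong₂ (λ s t → 1 * s + 2 * 𝟙 t) c (trans (cong (_≡ᵇ K) c) (T-true (≡⇒≡ᵇ K K refl))))
                                 (K+2≡2n n 1≤n)
          when-maximal : c₂ G x z ≡ 2 * n → 1 * c₂ G x z + 2 * 𝟙 (c₂ G x z ≡ᵇ K) ≡ 2 * n * 1
          when-maximal c = trans (cong₂ (λ s t → 1 * s + 2 * 𝟙 t) c (trans (cong (_≡ᵇ K) c) (¬T-false (λ t → 2n≢K n 1≤n (≡ᵇ⇒≡ (2 * n) K t)))))
                                 (trans (+-identityʳ _) (trans (+-identityʳ _) (sym (*-identityʳ _))))

    D-degree : V G → ℕ
    D-degree u = count (λ z → inD z ∧ adj z u)

    endpoint : V G → Bool
    endpoint u = (u == a) ∨ (u == b)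

    count-endpoints : count endpoint ≡ 2
    count-endpoints = trans (count-split (_== a) endpoint)
      (cong₂ _+_ (count-single _ a (∧-intro (==-refl a) (∨-introˡ (==-refl a))) (λ u t → ==→≡ (∧-elimˡ t)))
                 (count-single _ b (∧-intro (not-intro (λ e → b≢a (==→≡ e))) (∨-introʳ {b == a} (==-refl b))) is-b))
      where
      is-b : ∀ u → T (not (u == a) ∧ endpoint u) → u ≡ b
      is-b u t = [ (λ ta → ⊥-elim (not-elim (∧-elimˡ t) ta)) , ==→≡ ]′ (∨-elim {u == a} (∧-elimʳ {not (u == a)} t))

    count-xor : count (λ u → adj x u ∧ (adj a u xor adj b u)) ≡ 2 * n
    count-xor = trans (count-neighbours x (λ u → adj a u xor adj b u))
                      (trans (gcount-ext in-grid) (gcount-xor (cell x a x~a) (cell x b x~b) (~→rook-cell x x~a x~b a~b)))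
      where
      in-grid : ∀ p → (adj a (at x p) xor adj b (at x p)) ≡ (rook? (cell x a x~a) p xor rook? (cell x b x~b) p)
      in-grid p = cong₂ _xor_ (trans (cong (λ v → adj v (at x p)) (sym (at-cell x a x~a))) (adj-at x _ p))
                              (trans (cong (λ v → adj v (at x p)) (sym (at-cell x b x~b))) (adj-at x _ p))

    D-degree-split : ∀ u → D-degree u + (𝟙 (adj a u) + 𝟙 (adj b u)) ≡ C-degree u
    D-degree-split u = sym (trans (count-split (adj x) (λ z → inC z ∧ adj z u))
                                  (trans (cong₂ _+_ via-a-b (count-ext (λ z → rearrange (adj x z) (inC z) (adj z u))))
                                         (+-comm (𝟙 (adj a u) + 𝟙 (adj b u)) (D-degree u))))
      where
      rearrange : ∀ p q r → not p ∧ (q ∧ r) ≡ (q ∧ not p) ∧ r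
      rearrange true true r = refl
      rearrange true false r = refl
      rearrange false true r = refl
      rearrange false false r = refl
      f : V G → Bool
      f z = adj x z ∧ (inC z ∧ adj z u)
      via-a : count (λ z → (z == a) ∧ f z) ≡ 𝟙 (adj a u)
      via-a = trans (count-at _ a (λ z t → ==→≡ (∧-elimˡ t)))
                    (cong 𝟙 (T-ext (λ t → ∧-elimʳ {inC a} (∧-elimʳ {adj x a} (∧-elimʳ {a == a} t)))
                                   (λ t → ∧-intro (==-refl a) (∧-intro x~a (∧-intro a∈C t)))))
      via-b : count (λ z → not (z == a) ∧ f z) ≡ 𝟙 (adj b u)
      via-b = trans (count-at _ b is-b)
                    (cong 𝟙 (T-ext (λ t → ∧-elimʳ {inC b} (∧-elimʳ {adj x b} (∧-elimʳ {not (b == a)} t)))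
                                   (λ t → ∧-intro (not-intro (λ e → b≢a (==→≡ e))) (∧-intro x~b (∧-intro b∈C t)))))
        where
        is-b : ∀ z → T (not (z == a) ∧ f z) → z ≡ b
        is-b z t = let tf = ∧-elimʳ {not (z == a)} t in
          [ (λ e → ⊥-elim (not-elim (∧-elimˡ t) (≡→== e))) , (λ e → e) ]′
            (only-a-b z (∧-elimˡ (∧-elimʳ {adj x z} tf)) (∧-elimˡ tf))
      via-a-b : count f ≡ 𝟙 (adj a u) + 𝟙 (adj b u)
      via-a-b = trans (count-split (_== a) f) (cong₂ _+_ via-a via-b)

    -- A neighbour u ∉ {a, b} of x sees D once if it is adjacent to exactly one of a, b,
    -- never if adjacent to both, and twice if adjacent to neither but screened.
    outside-C : ∀ u → x ~ u → ¬ T (endpoint u) → ¬ T (inC u)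
    outside-C u x~u not-endpoint tu =
      not-endpoint ([ (λ e → ∨-introˡ (≡→== e)) , (λ e → ∨-introʳ {u == a} (≡→== e)) ]′ (only-a-b u tu x~u))

    balance : ∀ u → ¬ T (inC u) → D-degree u + (𝟙 (adj a u) + 𝟙 (adj b u)) ≡ 2 * 𝟙 (touches-C u)
    balance u u∉C = trans (D-degree-split u) (C-degree-outside u u∉C)

    inner-degree : ∀ u → x ~ u → ¬ T (endpoint u) → D-degree u ≡ 𝟙 (adj a u xor adj b u) + 2 * 𝟙 (screened u)
    inner-degree u x~u not-endpoint with T? (adj a u ∨ adj b u)
    ... | yes sees = begin
        D-degree u
      ≡⟨ one-sided (D-degree u) (adj a u) (adj b u) sees
                   (trans (balance u (outside-C u x~u not-endpoint)) (cong (λ t → 2 * 𝟙 t) (T-true (touching sees)))) ⟩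
        𝟙 (adj a u xor adj b u)
      ≡⟨ sym (trans (cong (λ t → 𝟙 (adj a u xor adj b u) + 2 * 𝟙 t) (¬T-false (not-screened sees))) (+-identityʳ _)) ⟩
        𝟙 (adj a u xor adj b u) + 2 * 𝟙 (screened u)
      ∎
      where
      open ≡-Reasoning
      touching : T (adj a u ∨ adj b u) → T (touches-C u)
      touching t = [ (λ au → any?-intro (λ z → inC z ∧ adj z u) a (∧-intro a∈C au)) ,
                     (λ bu → any?-intro (λ z → inC z ∧ adj z u) b (∧-intro b∈C bu)) ]′ (∨-elim {adj a u} t)
      not-screened : T (adj a u ∨ adj b u) → ¬ T (screened u)
      not-screened t su = [ (λ au → free a a∈C au x~a) , (λ bu → free b b∈C bu x~b) ]′ (∨-elim {adj a u} t)
        where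
        free = no-shared→ (∧-elimʳ {touches-C u} (∧-elimʳ {not (inC u)} (∧-elimʳ {adj x u} su)))
    ... | no blind = begin
        D-degree u
      ≡⟨ sym (trans (cong (D-degree u +_) (cong₂ (λ p q → 𝟙 p + 𝟙 q) a≁u b≁u)) (+-identityʳ _)) ⟩
        D-degree u + (𝟙 (adj a u) + 𝟙 (adj b u))
      ≡⟨ balance u u∉C ⟩
        2 * 𝟙 (touches-C u)
      ≡⟨ cong (λ t → 2 * 𝟙 t) (T-ext touching→screened screened→touching) ⟩
        2 * 𝟙 (screened u)
      ≡⟨ cong (λ t → 𝟙 t + 2 * 𝟙 (screened u)) (sym (cong₂ _xor_ a≁u b≁u)) ⟩
        𝟙 (adj a u xor adj b u) + 2 * 𝟙 (screened u)
      ∎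
      where
      open ≡-Reasoning
      u∉C = outside-C u x~u not-endpoint
      a≁u : adj a u ≡ false
      a≁u = ¬T-false (λ t → blind (∨-introˡ t))
      b≁u : adj b u ≡ false
      b≁u = ¬T-false (λ t → blind (∨-introʳ {adj a u} t))
      -- the only neighbours of x in C, a and b, are not adjacent to u
      touching→screened : T (touches-C u) → T (screened u)
      touching→screened t = ∧-intro x~u (∧-intro (not-intro u∉C) (∧-intro t (→no-shared (λ z tz zu xz →
        [ (λ e → blind (∨-introˡ (subst (_~ u) e zu))) , (λ e → blind (∨-introʳ {adj a u} (subst (_~ u) e zu))) ]′ (only-a-b z tz xz)))))
      screened→touching : T (screened u) → T (touches-C u)
      screened→touching t = ∧-elimˡ (∧-elimʳ {not (inC u)} (∧-elimʳ {adj x u} t))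

    -- The per-vertex identity  [p]·k + [e] = [p ∧ q] + 2[s] + K[e]  in its three shapes:
    -- at an endpoint, at a non-neighbour of x, and at any other neighbour of x.
    tally-endpoint : ∀ {p q s e : Bool} {k} m → p ≡ true → q ≡ true → s ≡ false → e ≡ true → k ≡ m →
                     𝟙 p * k + 𝟙 e ≡ 𝟙 (p ∧ q) + 2 * 𝟙 s + m * 𝟙 e
    tally-endpoint m refl refl refl refl refl =
      trans (cong (_+ 1) (+-identityʳ m)) (trans (+-comm m 1) (cong suc (sym (*-identityʳ m))))
    tally-far : ∀ {p q s e : Bool} {k} m → p ≡ false → s ≡ false → e ≡ false →
                𝟙 p * k + 𝟙 e ≡ 𝟙 (p ∧ q) + 2 * 𝟙 s + m * 𝟙 e
    tally-far m refl refl refl = sym (*-zeroʳ m)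
    tally-inner : ∀ {p q s e : Bool} {k} m → p ≡ true → e ≡ false → k ≡ 𝟙 q + 2 * 𝟙 s →
                  𝟙 p * k + 𝟙 e ≡ 𝟙 (p ∧ q) + 2 * 𝟙 s + m * 𝟙 e
    tally-inner {q = q} {s} m refl refl refl =
      trans (+-identityʳ _) (trans (+-identityʳ _) (sym (trans (cong (𝟙 q + 2 * 𝟙 s +_) (*-zeroʳ m)) (+-identityʳ _))))

    -- The identity behind the second count, in terms of the Boolean data of a vertex u:
    -- p = [x ~ u], q = [u adjacent to exactly one of a, b], s = [u screened], e = [u ∈ {a, b}], k = |Γ(u) ∩ D|.
    per-vertex : ∀ u → 𝟙 (adj x u) * D-degree u + 𝟙 (endpoint u) ≡
                       𝟙 (adj x u ∧ (adj a u xor adj b u)) + 2 * 𝟙 (screened u) + (n ∸ 1) * 𝟙 (endpoint u)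
    per-vertex u = by-cases (endpoint u) (adj x u) refl refl
      where
      -- at a and at b: D ⊆ Γ(v), so |Γ(v) ∩ D| = n - 1
      at-endpoint : ∀ v → T (inC v) → x ~ v → (adj a v xor adj b v) ≡ true → T (endpoint v) →
                    𝟙 (adj x v) * D-degree v + 𝟙 (endpoint v) ≡
                    𝟙 (adj x v ∧ (adj a v xor adj b v)) + 2 * 𝟙 (screened v) + (n ∸ 1) * 𝟙 (endpoint v)
      at-endpoint v v∈C xv exactly-one ev =
        tally-endpoint (n ∸ 1) (T-true xv) exactly-one (¬T-false (λ t → not-elim (∧-elimˡ (∧-elimʳ {adj x v} t)) v∈C)) (T-true ev)
          (trans (count-ext⇔ (λ z t → ∧-elimˡ t) (λ z t → ∧-intro t (~-sym (D⊆Γ v∈C xv z t)))) size-D)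
      by-cases : ∀ e p → endpoint u ≡ e → adj x u ≡ p →
                 𝟙 (adj x u) * D-degree u + 𝟙 (endpoint u) ≡
                 𝟙 (adj x u ∧ (adj a u xor adj b u)) + 2 * 𝟙 (screened u) + (n ∸ 1) * 𝟙 (endpoint u)
      by-cases true _ ee _ with ∨-elim {u == a} (true-T ee)
      ... | inj₁ ua rewrite ==→≡ ua = at-endpoint a a∈C x~a (cong₂ _xor_ (Graph.irrefl G a) (T-true (~-sym a~b))) (true-T ee)
      ... | inj₂ ub rewrite ==→≡ ub = at-endpoint b b∈C x~b (cong₂ _xor_ (T-true a~b) (Graph.irrefl G b)) (true-T ee)
      by-cases false false ee ep =
        tally-far {q = adj a u xor adj b u} {k = D-degree u} (n ∸ 1) ep (¬T-false (λ t → subst T ep (∧-elimˡ t))) ee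
      by-cases false true ee ep =
        tally-inner {q = adj a u xor adj b u} {s = screened u} (n ∸ 1) ep ee (inner-degree u (true-T ep) (λ t → subst T ee t))

    second-count : S + 2 ≡ 2 * n + 2 * count screened + (n ∸ 1) * 2
    second-count = begin
        S + 2
      ≡⟨ cong₂ _+_ (double-count x inD) (sym count-endpoints) ⟩
        sum (λ u → 𝟙 (adj x u) * D-degree u) + count endpoint
      ≡⟨ sym (∑-distrib-+ (λ u → 𝟙 (adj x u) * D-degree u) (λ u → 𝟙 (endpoint u))) ⟩
        sum (λ u → 𝟙 (adj x u) * D-degree u + 𝟙 (endpoint u))
      ≡⟨ sum-cong-≗ per-vertex ⟩
        sum (λ u → 𝟙 (adj x u ∧ (adj a u xor adj b u)) + 2 * 𝟙 (screened u) + (n ∸ 1) * 𝟙 (endpoint u))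
      ≡⟨ ∑-distrib-+ (λ u → 𝟙 (adj x u ∧ (adj a u xor adj b u)) + 2 * 𝟙 (screened u)) (λ u → (n ∸ 1) * 𝟙 (endpoint u)) ⟩
        sum (λ u → 𝟙 (adj x u ∧ (adj a u xor adj b u)) + 2 * 𝟙 (screened u)) + sum (λ u → (n ∸ 1) * 𝟙 (endpoint u))
      ≡⟨ cong₂ _+_ (∑-distrib-+ (λ u → 𝟙 (adj x u ∧ (adj a u xor adj b u))) (λ u → 2 * 𝟙 (screened u)))
                   (sym (*-distribˡ-sum (n ∸ 1) (λ u → 𝟙 (endpoint u)))) ⟩
        count (λ u → adj x u ∧ (adj a u xor adj b u)) + sum (λ u → 2 * 𝟙 (screened u)) + (n ∸ 1) * count endpoint
      ≡⟨ cong₂ _+_ (cong₂ _+_ count-xor (sym (*-distribˡ-sum 2 (λ u → 𝟙 (screened u))))) (cong ((n ∸ 1) *_) count-endpoints) ⟩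
        2 * n + 2 * count screened + (n ∸ 1) * 2
      ∎
      where open ≡-Reasoning

    -- Comparing the two counts: #minimal + #screened = (n-1)(n-2), and #screened is even.
    minimal-even : 2 ∣ count minimal
    minimal-even = parity-of-k n S (count minimal) (count screened) 2≤n
                     (trans first-count (cong (2 * n *_) size-D)) second-count screened-even

    minimal-set-even : ∀ (M : Subset N) → (∀ y → (y ∈ M) ⇔ (y ∈ C × Dist G x y 2 × c₂ G x y ≡ 2 * (n ∸ 1))) → 2 ∣ ∣ M ∣
    minimal-set-even M hM = subst (2 ∣_) (sym (trans (card≡count M) (count-ext⇔ to from))) minimal-even
      where
      to : ∀ y → T (lookup M y) → T (minimal y)
      to y t = let (y∈C , d , e) = Equivalence.to (hM y) (T→∈ t) in
        ∧-intro (∧-intro (∈→T y∈C) (not-intro (proj₁ (proj₂ (dist2-elim d))))) (≡⇒≡ᵇ (c₂ G x y) K e)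
      from : ∀ y → T (minimal y) → T (lookup M y)
      from y t = ∈→T (Equivalence.from (hM y)
                   (T→∈ (∧-elimˡ (∧-elimˡ t)) , D-at-distance-2 y (∧-elimˡ t) , ≡ᵇ⇒≡ (c₂ G x y) K (∧-elimʳ {inD y} t)))

    -- For even n, some z ∈ D has c₂(x,z) = 2n: otherwise all n - 1 vertices of D, an odd number, are minimal.
    maximal-exists : 2 ∣ n → ∃ λ z → z ∈ C × Dist G x z 2 × c₂ G x z ≡ 2 * n
    maximal-exists 2∣n with search (λ z → inD z ∧ (c₂ G x z ≡ᵇ 2 * n))
    ... | inj₁ (z , t) = z , T→∈ (∧-elimˡ (∧-elimˡ t)) , D-at-distance-2 z (∧-elimˡ t) , ≡ᵇ⇒≡ (c₂ G x z) (2 * n) (∧-elimʳ {inD z} t)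
    ... | inj₂ none = ⊥-elim (even-n⇒odd-pred n (count minimal) 1≤n 2∣n minimal-even (trans all-minimal size-D))
      where
      all-minimal : count minimal ≡ count inD
      all-minimal = count-ext⇔ (λ z t → ∧-elimˡ t)
        (λ z t → ∧-intro t ([ ≡⇒≡ᵇ (c₂ G x z) K , (λ e → ⊥-elim (none z (∧-intro t (≡⇒≡ᵇ (c₂ G x z) (2 * n) e)))) ]′ (c₂-values z t)))

lemma5p3 : (G : Graph) (n : ℕ) → LocallyGrid G n → Connected G → MuGraphsAtLeast G (2 * (n ∸ 1)) →
    DiamLe G 3 ×
    (∀ x C → IsMaximalClique G C → x ∉ C →
      (SetDist G x C 1 ⊎ SetDist G x C 2) ×
      (SetDist G x C 1 →
        (∀ (S : Subset (Graph.N G)) → (∀ y → (y ∈ S) ⇔ (y ∈ C × Dist G x y 2 × c₂ G x y ≡ 2 * (n ∸ 1))) → 2 ∣ ∣ S ∣) ×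
        (2 ∣ n → ∃ λ z → z ∈ C × Dist G x z 2 × c₂ G x z ≡ 2 * n)) ×
      (SetDist G x C 2 →
        (∀ y → y ∈ C → Dist G x y 2 → c₂ G x y ≡ 2 * (n ∸ 1)) ×
        (2 ∣ n → ∃ λ z → z ∈ C × ¬ Dist G x z 2)))
lemma5p3 G n lg conn μ-bound = diameter≤3 , λ x C mc x∉C →
  let open OutsideVertex G n lg conn μ-bound C mc x x∉C in
  set-dist-1-or-2 ,
  (λ near → let (a , a∈C , x~a) = neighbour-in-C near
                open NearClique a a∈C x~a
            in minimal-set-even , maximal-exists) ,
  (λ far → let open FarFromClique far in μ-minimal , not-all-at-distance-2)
  where
  open Diameter G n lg conn μ-bound using (diameter≤3)
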